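{- Let $G$ be a planar graph with maximum degree at most four that has no packing $(1^2,2^7)$-coloring, chosen with $|V(G)|+|E(G)|$ minimum among all such graphs. Then for every $3$-cycle $C$ of $G$, at most one edge of $C$ is shared with another $3$-cycle of $G$.
   Context: A set of vertices is $i$-independent if any two distinct vertices in it are at distance at least $i+1$. A packing $(1^2,2^7)$-coloring of $G$ is a partition of $V(G)$ into two independent sets and seven $2$-independent sets. -}

module Defs where

open import Data.Nat using (ℕ; zero; suc; _+_; _≤_; _<ᵇ_)
open import Data.Fin using (Fin; toℕ)
open import Data.Bool using (Bool; true; false; _∧_)
open import Data.Product using (Σ; _×_; _,_; ∃)
open import Data.Sum using (_⊎_)
open import Data.Empty using (⊥)
open import Relation.Nullary using (¬_)
open import Relation.Binary.PropositionalEquality using (_≡_; _≢_)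
open import Data.Rational as ℚ using (ℚ; 0ℚ; 1ℚ)

record Graph : Set where
  field
    n     : ℕ
    adj   : Fin n → Fin n → Bool
    sym   : ∀ u v → adj u v ≡ adj v u
    irrfl : ∀ u → adj u u ≡ false
open Graph public

count : {m : ℕ} → (Fin m → Bool) → ℕ
count {zero}  f = 0
count {suc m} f = (if' (f Data.Fin.zero)) + count (λ i → f (Data.Fin.suc i))
  where
  if' : Bool → ℕ
  if' true  = 1
  if' false = 0

sumFin : {m : ℕ} → (Fin m → ℕ) → ℕ
sumFin {zero}  f = 0
sumFin {suc m} f = f Data.Fin.zero + sumFin (λ i → f (Data.Fin.suc i))

Adj : (G : Graph) → Fin (n G) → Fin (n G) → Set
Adj G u v = adj G u v ≡ true

degree : (G : Graph) → Fin (n G) → ℕ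
degree G v = count (adj G v)

edgeCount : Graph → ℕ
edgeCount G = sumFin (λ u → count (λ v → adj G u v ∧ (toℕ u <ᵇ toℕ v)))

size : Graph → ℕ
size G = n G + edgeCount G

MaxDegreeAtMost : Graph → ℕ → Set
MaxDegreeAtMost G d = ∀ v → degree G v ≤ d

data Walk (G : Graph) : Fin (n G) → Fin (n G) → ℕ → Set where
  here : ∀ {u} → Walk G u u 0
  step : ∀ {u v w k} → Adj G u v → Walk G v w k → Walk G u w (suc k)

DistAtLeastSuc : (G : Graph) → Fin (n G) → Fin (n G) → ℕ → Set
DistAtLeastSuc G u v i = ∀ k → k ≤ i → ¬ Walk G u v k

-- packing (1^2,2^7)-coloring: colour classes 0,1 are 1-independent,
-- colour classes 2..8 are 2-independent
packSize : Fin 9 → ℕ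
packSize c with toℕ c
... | 0 = 1
... | 1 = 1
... | _ = 2

IsPacking1²2⁷Coloring : (G : Graph) → (Fin (n G) → Fin 9) → Set
IsPacking1²2⁷Coloring G c =
  ∀ u v → u ≢ v → c u ≡ c v → DistAtLeastSuc G u v (packSize (c u))

HasPacking1²2⁷Coloring : Graph → Set
HasPacking1²2⁷Coloring G = Σ (Fin (n G) → Fin 9) (IsPacking1²2⁷Coloring G)

-- Planarity: straight-line plane drawing with rational coordinates
-- (equivalent to the usual notion by Fáry's theorem).
Point : Set
Point = ℚ × ℚ

OnSegment : Point → Point → Point → Set
OnSegment (px , py) (qx , qy) (x , y) =
  Σ ℚ λ t → (0ℚ ℚ.≤ t) × (t ℚ.≤ 1ℚ)
    × (x ≡ px ℚ.+ t ℚ.* (qx ℚ.- px)) × (y ≡ py ℚ.+ t ℚ.* (qy ℚ.- py))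

IsPlaneDrawing : (G : Graph) → (Fin (n G) → Point) → Set
IsPlaneDrawing G pos =
  (∀ u v → pos u ≡ pos v → u ≡ v)
  × (∀ a b w → Adj G a b → w ≢ a → w ≢ b → ¬ OnSegment (pos a) (pos b) (pos w))
  × (∀ a b c d X → Adj G a b → Adj G c d
       → OnSegment (pos a) (pos b) X → OnSegment (pos c) (pos d) X
       → ((a ≡ c) × (b ≡ d)) ⊎ ((a ≡ d) × (b ≡ c))
         ⊎ (Σ (Fin (n G)) λ w → ((w ≡ a) ⊎ (w ≡ b)) × ((w ≡ c) ⊎ (w ≡ d)) × (X ≡ pos w)))

Planar : Graph → Set
Planar G = Σ (Fin (n G) → Point) (IsPlaneDrawing G)

Bad : Graph → Set
Bad G = Planar G × MaxDegreeAtMost G 4 × ¬ HasPacking1²2⁷Coloring G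

MinimalBad : Graph → Set
MinimalBad G = Bad G × (∀ H → Bad H → size G ≤ size H)

Triangle : (G : Graph) → Fin (n G) → Fin (n G) → Fin (n G) → Set
Triangle G a b c = Adj G a b × Adj G b c × Adj G c a

EdgeShared : (G : Graph) → Fin (n G) → Fin (n G) → Fin (n G) → Set
EdgeShared G a b c = Σ (Fin (n G)) λ d → d ≢ c × Adj G a d × Adj G b d

{-# OPTIONS --safe #-}
-- Let abd and bce be the triangles that share the edges ab and bc with abc. By minimality G − ab has a
-- packing colouring, which we extend to G.
-- If d ≠ e, the neighbours of b are exactly a, c, d, e. Uncolour b and make the colouring tidy: every
-- class-2 vertex sees both class-1 colours, else it takes the missing one. If b still cannot be coloured,
-- the vertices within distance two of b carry all seven class-2 colours and, by tidiness, a number of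
-- class-1 vertices; the degree bound leaves too little room for both, except in one configuration up to
-- reflection (c class-2 between a and e of distinct class-1 colours), where e takes the colour of a, c
-- that of e, and b that of c.
-- If d = e, then a, b, c, d span a K₄ and each of them has at most one further neighbour; uncolour a
-- and b, make the colouring tidy, and the same kind of count finds colours for both.
module Submission where

open import Defs hiding (sym)
open import Data.Bool using (Bool; true; false; _∧_; _∨_; not; if_then_else_)
import Data.Bool.Properties as Boolₚ
open import Data.Empty using (⊥; ⊥-elim)
open import Data.Fin using (Fin; zero; suc; toℕ; _↑ʳ_; _≟_)
import Data.Fin.Properties as Finₚ
open import Data.List using (List; []; _∷_; _++_; length; filter; allFin; tabulate; map; concatMap)
open import Data.List.Properties using (length-++; length-map; length-removeAt′; length-filter; filter-++; ++-identityʳ)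
open import Data.List.Membership.Propositional using (_∈_; _∉_; _─_; find; lose)
import Data.List.Membership.DecPropositional as DecMembership
open import Data.List.Membership.Propositional.Properties
  using (∈-filter⁺; ∈-filter⁻; ∈-allFin; ∈-++⁺ˡ; ∈-++⁺ʳ; ∈-++⁻; ∈-map⁺; ∈-tabulate⁻; ∈-concat⁺′)
open import Data.List.Relation.Binary.Subset.Propositional using (_⊆_)
open import Data.List.Relation.Unary.All as All using (All; []; _∷_)
open import Data.List.Relation.Unary.AllPairs using ([]; _∷_)
open import Data.List.Relation.Unary.Any as Any using (here; there; index)
open import Data.List.Relation.Unary.Unique.Propositional using (Unique)
import Data.List.Relation.Unary.Unique.Propositional.Properties as Uniqueₚ
open import Data.Nat using (ℕ; suc; _+_; _∸_; _≤_; _<_; _<ᵇ_; _<?_; z≤n; s≤s)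
import Data.Nat as ℕ
open import Data.Nat.Induction using (<-wellFounded)
open import Data.Nat.ListAction using (sum)
open import Data.Nat.Properties
  using (+-suc; +-comm; ≤-refl; ≤-trans; ≤-reflexive; n≤1+n; m≤n⇒m≤1+n; 1+n≰n; <⇒≱; <⇒<ᵇ; n≢0⇒n>0;
         +-mono-≤; +-mono-<-≤; +-mono-≤-<; +-monoʳ-<; ∸-monoʳ-≤; m+n≤o⇒m≤o; m+n≤o⇒m≤o∸n)
open import Data.Product using (∃; _×_; _,_; proj₁; proj₂)
open import Data.Sum using (_⊎_; inj₁; inj₂; [_,_])
open import Data.Unit using (⊤; tt)
open import Data.Vec.Functional using (updateAt)
open import Data.Vec.Functional.Properties using (updateAt-updates; updateAt-minimal)
open import Function using (_∘_)
open import Function.Bundles using (Equivalence)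
open import Induction.WellFounded using (Acc; acc)
open import Level using (0ℓ)
open import Relation.Binary.Definitions using (DecidableEquality; tri<; tri≈; tri>)
open import Relation.Binary.PropositionalEquality
  using (_≡_; _≢_; refl; sym; trans; cong; cong₂; subst; subst₂; ≢-sym)
open import Relation.Nullary using (¬_; Dec; yes; no; does; ¬?; _×-dec_; _⊎-dec_; _→-dec_)
open import Relation.Nullary.Decidable using (dec-true; toWitness)
open import Relation.Unary using (Pred; Decidable)
open import Relation.Unary.Properties using (∁?)

-- Counting

module _ {A : Set} where

  ∈-─⁺ : ∀ {x z : A} {ys} (x∈ys : x ∈ ys) → z ∈ ys → z ≢ x → z ∈ ys ─ x∈ys
  ∈-─⁺ (here refl) (here refl)  z≢x = ⊥-elim (z≢x refl)
  ∈-─⁺ (here refl) (there z∈ys) _   = z∈ys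
  ∈-─⁺ (there _)   (here refl)  _   = here refl
  ∈-─⁺ (there x∈ys) (there z∈ys) z≢x = there (∈-─⁺ x∈ys z∈ys z≢x)

  Unique-⊆⇒length≤ : ∀ {xs ys : List A} → Unique xs → xs ⊆ ys → length xs ≤ length ys
  Unique-⊆⇒length≤ {[]}     _              _     = z≤n
  Unique-⊆⇒length≤ {x ∷ xs} {ys} (x∉xs ∷ xs!) xs⊆ys =
    subst (suc (length xs) ≤_) (sym (length-removeAt′ ys (index x∈ys)))
      (s≤s (Unique-⊆⇒length≤ xs! λ z∈xs →
        ∈-─⁺ x∈ys (xs⊆ys (there z∈xs)) (≢-sym (All.lookup x∉xs z∈xs))))
    where
    x∈ys : x ∈ ys
    x∈ys = xs⊆ys (here refl)

  ∈-++-∷⁻ : ∀ {x y : A} xs {ys} → x ∈ xs ++ y ∷ ys → x ≢ y → x ∈ xs ++ ys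
  ∈-++-∷⁻ []       (here refl) x≢y = ⊥-elim (x≢y refl)
  ∈-++-∷⁻ []       (there x∈)  _   = x∈
  ∈-++-∷⁻ (_ ∷ xs) (here refl) _   = here refl
  ∈-++-∷⁻ (_ ∷ xs) (there x∈)  x≢y = there (∈-++-∷⁻ xs x∈ x≢y)

module _ {A : Set} {P Q : Pred A 0ℓ} (P? : Decidable P) (Q? : Decidable Q) where

  length-filter-mono : (∀ {x} → P x → Q x) → ∀ xs → length (filter P? xs) ≤ length (filter Q? xs)
  length-filter-mono P⊆Q []       = z≤n
  length-filter-mono P⊆Q (x ∷ xs) with P? x | Q? x
  ... | yes _  | yes _  = s≤s (length-filter-mono P⊆Q xs)
  ... | yes px | no ¬qx = ⊥-elim (¬qx (P⊆Q px))
  ... | no _   | yes _  = m≤n⇒m≤1+n (length-filter-mono P⊆Q xs)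
  ... | no _   | no _   = length-filter-mono P⊆Q xs

  length-filter-mono-< : (∀ {x} → P x → Q x) → ∀ {x} xs → x ∈ xs → ¬ P x → Q x
                       → length (filter P? xs) < length (filter Q? xs)
  length-filter-mono-< P⊆Q (y ∷ xs) (here refl) ¬py qy with P? y | Q? y
  ... | yes py | _      = ⊥-elim (¬py py)
  ... | no _   | no ¬qy = ⊥-elim (¬qy qy)
  ... | no _   | yes _  = s≤s (length-filter-mono P⊆Q xs)
  length-filter-mono-< P⊆Q (y ∷ xs) (there x∈xs) ¬px qx with P? y | Q? y
  ... | yes _  | yes _  = s≤s (length-filter-mono-< P⊆Q xs x∈xs ¬px qx)
  ... | yes py | no ¬qy = ⊥-elim (¬qy (P⊆Q py))
  ... | no _   | yes _  = m≤n⇒m≤1+n (length-filter-mono-< P⊆Q xs x∈xs ¬px qx)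
  ... | no _   | no _   = length-filter-mono-< P⊆Q xs x∈xs ¬px qx

module _ {A : Set} {P : Pred A 0ℓ} (P? : Decidable P) where

  length-filter+length-filter-∁ : ∀ xs → length (filter P? xs) + length (filter (∁? P?) xs) ≡ length xs
  length-filter+length-filter-∁ []       = refl
  length-filter+length-filter-∁ (x ∷ xs) with P? x
  ... | yes _ = cong suc (length-filter+length-filter-∁ xs)
  ... | no _  = trans (+-suc _ _) (cong suc (length-filter+length-filter-∁ xs))

  length-filter-++ : ∀ xs ys → length (filter P? (xs ++ ys)) ≡ length (filter P? xs) + length (filter P? ys)
  length-filter-++ xs ys = trans (cong length (filter-++ P? xs ys)) (length-++ (filter P? xs))

  length-filter-++-∷ : ∀ xs {y} ys → P y → length (filter P? (xs ++ y ∷ ys)) ≡ suc (length (filter P? (xs ++ ys)))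
  length-filter-++-∷ [] {y} ys py with P? y
  ... | yes _  = refl
  ... | no ¬py = ⊥-elim (¬py py)
  length-filter-++-∷ (x ∷ xs) ys py with P? x
  ... | yes _ = cong suc (length-filter-++-∷ xs ys py)
  ... | no _  = length-filter-++-∷ xs ys py

  ∈⇒1≤length-filter : ∀ {x xs} → x ∈ xs → P x → 1 ≤ length (filter P? xs)
  ∈⇒1≤length-filter x∈xs px =
    Unique-⊆⇒length≤ ([] ∷ []) λ { (here refl) → ∈-filter⁺ P? x∈xs px }

  ∈⇒2≤length-filter : ∀ {x y xs} → x ∈ xs → y ∈ xs → x ≢ y → P x → P y → 2 ≤ length (filter P? xs)
  ∈⇒2≤length-filter x∈xs y∈xs x≢y px py =
    Unique-⊆⇒length≤ ((x≢y ∷ []) ∷ [] ∷ [])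
      λ { (here refl) → ∈-filter⁺ P? x∈xs px ; (there (here refl)) → ∈-filter⁺ P? y∈xs py }

true≢false : true ≢ false
true≢false ()

count-tabulate : ∀ {m} {B : Set} (h : Fin m → B) (p : B → Bool)
               → count (p ∘ h) ≡ length (filter (λ x → p x Boolₚ.≟ true) (tabulate h))
count-tabulate {0}     h p = refl
count-tabulate {suc m} h p with p (h zero)
... | true  = cong suc (count-tabulate (h ∘ suc) p)
... | false = count-tabulate (h ∘ suc) p

count≡length-filter : ∀ {m} (f : Fin m → Bool) → count f ≡ length (filter (λ i → f i Boolₚ.≟ true) (allFin m))
count≡length-filter = count-tabulate (λ i → i)

count-mono : ∀ {m} (f g : Fin m → Bool) → (∀ {i} → f i ≡ true → g i ≡ true) → count f ≤ count g
count-mono f g f⊆g =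
  subst₂ _≤_ (sym (count≡length-filter f)) (sym (count≡length-filter g))
    (length-filter-mono (λ i → f i Boolₚ.≟ true) (λ i → g i Boolₚ.≟ true) f⊆g (allFin _))

count-mono-< : ∀ {m} (f g : Fin m → Bool) → (∀ {i} → f i ≡ true → g i ≡ true)
             → ∀ i → f i ≡ false → g i ≡ true → count f < count g
count-mono-< f g f⊆g i fi gi =
  subst₂ _<_ (sym (count≡length-filter f)) (sym (count≡length-filter g))
    (length-filter-mono-< (λ i → f i Boolₚ.≟ true) (λ i → g i Boolₚ.≟ true) f⊆g (allFin _) (∈-allFin i)
      (λ fi′ → true≢false (trans (sym fi′) fi)) gi)

sumFin-mono : ∀ {m} (f g : Fin m → ℕ) → (∀ i → f i ≤ g i) → sumFin f ≤ sumFin g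
sumFin-mono {0}     f g f≤g = z≤n
sumFin-mono {suc m} f g f≤g = +-mono-≤ (f≤g zero) (sumFin-mono (f ∘ suc) (g ∘ suc) (f≤g ∘ suc))

sumFin-mono-< : ∀ {m} (f g : Fin m → ℕ) → (∀ i → f i ≤ g i) → ∀ i → f i < g i → sumFin f < sumFin g
sumFin-mono-< f g f≤g zero    fi<gi = +-mono-<-≤ fi<gi (sumFin-mono (f ∘ suc) (g ∘ suc) (f≤g ∘ suc))
sumFin-mono-< f g f≤g (suc i) fi<gi = +-mono-≤-< (f≤g zero) (sumFin-mono-< (f ∘ suc) (g ∘ suc) (f≤g ∘ suc) i fi<gi)

-- Graphs and edge removal

module GraphProperties (G : Graph) where

  V : Set
  V = Fin (n G)

  Adj-sym : ∀ {u v} → Adj G u v → Adj G v u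
  Adj-sym {u} {v} uv = trans (Graph.sym G v u) uv

  Adj-irrefl : ∀ {u} → ¬ Adj G u u
  Adj-irrefl {u} uu = true≢false (trans (sym uu) (irrfl G u))

  Adj⇒≢ : ∀ {u v} → Adj G u v → u ≢ v
  Adj⇒≢ uv refl = Adj-irrefl uv

  ¬Adj : ∀ {u v} → adj G u v ≡ false → ¬ Adj G u v
  ¬Adj uv≡false uv = true≢false (trans (sym uv) uv≡false)

  Adj? : ∀ v → Decidable (Adj G v)
  Adj? v u = adj G v u Boolₚ.≟ true

  length≤degree : ∀ {v xs} → Unique xs → All (Adj G v) xs → length xs ≤ degree G v
  length≤degree {v} xs! adjs =
    subst (_ ≤_) (sym (count≡length-filter (adj G v)))
      (Unique-⊆⇒length≤ xs! λ u∈xs → ∈-filter⁺ (Adj? v) (∈-allFin _) (All.lookup adjs u∈xs))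

  Near : V → V → Set
  Near v u = Adj G v u ⊎ ∃ λ w → Adj G v w × Adj G w u

  Near? : ∀ v → Decidable (Near v)
  Near? v u = Adj? v u ⊎-dec Finₚ.any? (λ w → Adj? v w ×-dec Adj? w u)

module Outside (G : Graph) (core : List (Fin (n G))) where

  open GraphProperties G
  open DecMembership (_≟_ {n G}) using (_∈?_)

  outside? : (y : V) → Decidable (λ u → Adj G y u × u ∉ core)
  outside? y u = Adj? y u ×-dec ¬? (u ∈? core)

  outer : V → List V
  outer y = filter (outside? y) (allFin (n G))

  ∈-outer⁺ : ∀ {y u} → Adj G y u → u ∉ core → u ∈ outer y
  ∈-outer⁺ {y} yu u∉core = ∈-filter⁺ (outside? y) (∈-allFin _) (yu , u∉core)

  ∈-outer⁻ : ∀ {y u} → u ∈ outer y → Adj G y u × u ∉ core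
  ∈-outer⁻ {y} u∈ = proj₂ (∈-filter⁻ (outside? y) {xs = allFin (n G)} u∈)

  length-outer++≤degree : ∀ y {xs} → Unique xs → All (_∈ core) xs → All (Adj G y) xs
                        → length (outer y) + length xs ≤ degree G y
  length-outer++≤degree y {xs} xs! xs⊆core adjs = subst (_≤ degree G y) (length-++ (outer y))
    (length≤degree distinct (All.tabulate λ {v} v∈ → neighbour (∈-++⁻ (outer y) v∈)))
    where
    distinct : Unique (outer y ++ xs)
    distinct = Uniqueₚ.++⁺ (Uniqueₚ.filter⁺ (outside? y) (Uniqueₚ.allFin⁺ (n G))) xs!
      λ (v∈outer , v∈xs) → proj₂ (∈-outer⁻ v∈outer) (All.lookup xs⊆core v∈xs)
    neighbour : ∀ {v} → v ∈ outer y ⊎ v ∈ xs → Adj G y v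
    neighbour (inj₁ v∈outer) = proj₁ (∈-outer⁻ v∈outer)
    neighbour (inj₂ v∈xs)    = All.lookup adjs v∈xs

joins : ∀ {m} → Fin m → Fin m → Fin m → Fin m → Bool
joins a b u v = (does (u ≟ a) ∧ does (v ≟ b)) ∨ (does (u ≟ b) ∧ does (v ≟ a))

joins-sym : ∀ {m} (a b u v : Fin m) → joins a b u v ≡ joins a b v u
joins-sym a b u v = trans (cong₂ _∨_ (Boolₚ.∧-comm (does (u ≟ a)) _) (Boolₚ.∧-comm (does (u ≟ b)) _))
                          (Boolₚ.∨-comm (does (v ≟ b) ∧ does (u ≟ a)) _)

removeEdge : (G : Graph) → Fin (n G) → Fin (n G) → Graph
removeEdge G a b = record
  { n     = n G
  ; adj   = λ u v → adj G u v ∧ not (joins a b u v)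
  ; sym   = λ u v → cong₂ _∧_ (Graph.sym G u v) (cong not (joins-sym a b u v))
  ; irrfl = λ u → cong (_∧ _) (irrfl G u)
  }

module RemoveEdge (G : Graph) (a b : Fin (n G)) where

  open GraphProperties G

  private
    H : Graph
    H = removeEdge G a b

  Adj-removeEdge⁻ : ∀ {u v} → Adj H u v → Adj G u v
  Adj-removeEdge⁻ {u} {v} uv with adj G u v
  ... | true = refl

  Adj-removeEdge⁺ : ∀ {u v} → Adj G u v → (u ≡ a → v ≢ b) → (u ≡ b → v ≢ a) → Adj H u v
  Adj-removeEdge⁺ {u} {v} uv notAB notBA with u ≟ a | v ≟ b | u ≟ b | v ≟ a
  ... | yes u≡a | yes v≡b | _     | _       = ⊥-elim (notAB u≡a v≡b)
  ... | _       | _       | yes u≡b | yes v≡a = ⊥-elim (notBA u≡b v≡a)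
  ... | no _    | _       | no _  | _       = trans (Boolₚ.∧-identityʳ _) uv
  ... | no _    | _       | yes _ | no _    = trans (Boolₚ.∧-identityʳ _) uv
  ... | yes _   | no _    | no _  | _       = trans (Boolₚ.∧-identityʳ _) uv
  ... | yes _   | no _    | yes _ | no _    = trans (Boolₚ.∧-identityʳ _) uv

  Adj-removeEdge⁺ˡ : ∀ {u v} → Adj G u v → u ≢ a → u ≢ b → Adj H u v
  Adj-removeEdge⁺ˡ uv u≢a u≢b = Adj-removeEdge⁺ uv (⊥-elim ∘ u≢a) (⊥-elim ∘ u≢b)

  Adj-removeEdge⁺-≢b : ∀ {u v} → Adj G u v → u ≢ b → v ≢ b → Adj H u v
  Adj-removeEdge⁺-≢b uv u≢b v≢b = Adj-removeEdge⁺ uv (λ _ → v≢b) (⊥-elim ∘ u≢b)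

  removeEdge-planar : Planar G → Planar H
  removeEdge-planar (pos , injective , avoidsVertices , crossings) =
    pos , injective , (λ x y w xy → avoidsVertices x y w (Adj-removeEdge⁻ xy)) ,
    (λ x y z t X xy zt → crossings x y z t X (Adj-removeEdge⁻ xy) (Adj-removeEdge⁻ zt))

  removeEdge-maxDegree : ∀ {Δ} → MaxDegreeAtMost G Δ → MaxDegreeAtMost H Δ
  removeEdge-maxDegree Δ-bound v = ≤-trans (count-mono (adj H v) (adj G v) Adj-removeEdge⁻) (Δ-bound v)

  private
    row : (G′ : Graph) → Fin (n G′) → Fin (n G′) → Bool
    row G′ u v = adj G′ u v ∧ (toℕ u <ᵇ toℕ v)

    ∧-not-∧ : ∀ x y z → (x ∧ not y) ∧ z ≡ true → x ∧ z ≡ true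
    ∧-not-∧ true  false true  _  = refl
    ∧-not-∧ true  false false ()
    ∧-not-∧ true  true  _     ()
    ∧-not-∧ false _     _     ()

    row⊆ : ∀ x {y} → row H x y ≡ true → row G x y ≡ true
    row⊆ x {y} = ∧-not-∧ (adj G x y) (joins a b x y) (toℕ x <ᵇ toℕ y)

    edgeCount-drops : ∀ {u v} → Adj G u v → joins a b u v ≡ true → toℕ u < toℕ v → edgeCount H < edgeCount G
    edgeCount-drops {u} {v} uv uv-joins u<v =
      sumFin-mono-< (λ x → count (row H x)) (λ x → count (row G x)) (λ x → count-mono (row H x) (row G x) (row⊆ x)) u
        (count-mono-< (row H u) (row G u) (row⊆ u) v dropped
          (cong₂ _∧_ uv (Equivalence.to Boolₚ.T-≡ (<⇒<ᵇ u<v))))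
      where
      dropped : (adj G u v ∧ not (joins a b u v)) ∧ (toℕ u <ᵇ toℕ v) ≡ false
      dropped rewrite uv-joins | Boolₚ.∧-zeroʳ (adj G u v) = refl

  removeEdge-size< : Adj G a b → size H < size G
  removeEdge-size< ab with Finₚ.<-cmp a b
  ... | tri< a<b _ _ = +-monoʳ-< (n G) (edgeCount-drops ab joins-ab a<b)
    where
    joins-ab : joins a b a b ≡ true
    joins-ab rewrite dec-true (a ≟ a) refl | dec-true (b ≟ b) refl = refl
  ... | tri≈ _ a≡b _ = ⊥-elim (Adj⇒≢ ab a≡b)
  ... | tri> _ _ b<a = +-monoʳ-< (n G) (edgeCount-drops (Adj-sym ab) joins-ba b<a)
    where
    joins-ba : joins a b b a ≡ true
    joins-ba rewrite dec-true (a ≟ a) refl | dec-true (b ≟ b) refl = Boolₚ.∨-zeroʳ _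

minimalBad-removeEdge : ∀ {G a b} → MinimalBad G → Adj G a b
                      → ¬ (HasPacking1²2⁷Coloring (removeEdge G a b) → HasPacking1²2⁷Coloring G)
minimalBad-removeEdge {G} {a} {b} ((planar , Δ≤4 , uncolourable) , minimal) ab extend =
  <⇒≱ (removeEdge-size< ab) (minimal _ (removeEdge-planar planar , removeEdge-maxDegree Δ≤4 , uncolourable ∘ extend))
  where open RemoveEdge G a b

-- Partial packing colourings

data Class₁ : Fin 9 → Set where
  first  : Class₁ zero
  second : Class₁ (suc zero)

Class₂ : Fin 9 → Set
Class₂ c = ¬ Class₁ c

class₁? : Decidable Class₁
class₁? zero          = yes first
class₁? (suc zero)    = yes second
class₁? (suc (suc _)) = no λ ()

0≢1 : zero ≢ suc {8} zero
0≢1 ()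

colour-≢⇒≢ : ∀ {A : Set} (ψ : A → Fin 9) {x y i j} → ψ x ≡ i → ψ y ≡ j → i ≢ j → x ≢ y
colour-≢⇒≢ ψ ψx≡i ψy≡j i≢j refl = i≢j (trans (sym ψx≡i) ψy≡j)

packSize-class₁ : ∀ {c} → Class₁ c → packSize c ≡ 1
packSize-class₁ first  = refl
packSize-class₁ second = refl

packSize-class₂ : ∀ {c} → Class₂ c → packSize c ≡ 2
packSize-class₂ {zero}          c₂ = ⊥-elim (c₂ first)
packSize-class₂ {suc zero}      c₂ = ⊥-elim (c₂ second)
packSize-class₂ {suc (suc _)}   _  = refl

packSize≤2 : ∀ c → packSize c ≤ 2
packSize≤2 c with class₁? c
... | yes c₁ = ≤-trans (≤-reflexive (packSize-class₁ c₁)) (n≤1+n 1)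
... | no c₂  = ≤-reflexive (packSize-class₂ c₂)

1≤packSize : ∀ c → 1 ≤ packSize c
1≤packSize c with class₁? c
... | yes c₁ = ≤-reflexive (sym (packSize-class₁ c₁))
... | no c₂  = ≤-trans (n≤1+n 1) (≤-reflexive (sym (packSize-class₂ c₂)))

class₂? : Decidable Class₂
class₂? c = ¬? (class₁? c)

class₂Colours : List (Fin 9)
class₂Colours = tabulate {n = 7} (2 ↑ʳ_)

∈-class₂Colours⇒class₂ : ∀ {k} → k ∈ class₂Colours → Class₂ k
∈-class₂Colours⇒class₂ k∈ with ∈-tabulate⁻ {f = λ (i : Fin 7) → 2 ↑ʳ i} k∈
... | _ , refl = λ ()

class₂Colours-unique : Unique class₂Colours
class₂Colours-unique = Uniqueₚ.tabulate⁺ {f = λ (i : Fin 7) → 2 ↑ʳ i} λ { refl → refl }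

module _ {A : Set} (ψ : A → Fin 9) where

  #₁ #₂ : List A → ℕ
  #₁ xs = length (filter (class₁? ∘ ψ) xs)
  #₂ xs = length (filter (class₂? ∘ ψ) xs)

  #₁-++ : ∀ xs ys → #₁ (xs ++ ys) ≡ #₁ xs + #₁ ys
  #₁-++ = length-filter-++ (class₁? ∘ ψ)

  #₂-++ : ∀ xs ys → #₂ (xs ++ ys) ≡ #₂ xs + #₂ ys
  #₂-++ = length-filter-++ (class₂? ∘ ψ)

  #₁+#₂≡length : ∀ xs → #₁ xs + #₂ xs ≡ length xs
  #₁+#₂≡length = length-filter+length-filter-∁ (class₁? ∘ ψ)

  7≤#₂ : ∀ {xs} → (∀ {k} → Class₂ k → ∃ λ u → u ∈ xs × ψ u ≡ k) → 7 ≤ #₂ xs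
  7≤#₂ {xs} seen = subst (7 ≤_) (length-map ψ (filter (class₂? ∘ ψ) xs))
    (Unique-⊆⇒length≤ class₂Colours-unique covered)
    where
    covered : ∀ {k} → k ∈ class₂Colours → k ∈ map ψ (filter (class₂? ∘ ψ) xs)
    covered {k} k∈ with seen (∈-class₂Colours⇒class₂ k∈)
    ... | u , u∈xs , ψu≡k = subst (_∈ map ψ (filter (class₂? ∘ ψ) xs)) ψu≡k
      (∈-map⁺ ψ (∈-filter⁺ (class₂? ∘ ψ) u∈xs (subst Class₂ (sym ψu≡k) (∈-class₂Colours⇒class₂ k∈))))

module Packing (G : Graph) where

  open GraphProperties G
  open DecMembership (_≟_ {9}) using (_∈?_)

  record IsPackingOn (D : Pred V 0ℓ) (ψ : V → Fin 9) : Set where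
    field
      adjacent  : ∀ {u v} → D u → D v → Adj G u v → ψ u ≢ ψ v
      distance2 : ∀ {u w v} → D u → D v → Adj G u w → Adj G w v → u ≢ v → ψ u ≡ ψ v → Class₁ (ψ u)

  open IsPackingOn public

  Everywhere : Pred V 0ℓ
  Everywhere _ = ⊤

  packing⇒packingOn : ∀ {ψ} → IsPacking1²2⁷Coloring G ψ → IsPackingOn Everywhere ψ
  packing⇒packingOn {ψ} packing .adjacent {u} {v} _ _ uv ψu≡ψv =
    packing u v (Adj⇒≢ uv) ψu≡ψv 1 (1≤packSize (ψ u)) (step uv here)
  packing⇒packingOn {ψ} packing .distance2 {u} {w} {v} _ _ uw wv u≢v ψu≡ψv with class₁? (ψ u)
  ... | yes c₁ = c₁
  ... | no c₂  = ⊥-elim (packing u v u≢v ψu≡ψv 2 (≤-reflexive (sym (packSize-class₂ c₂))) (step uw (step wv here)))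

  packingOn⇒packing : ∀ {ψ} → IsPackingOn Everywhere ψ → IsPacking1²2⁷Coloring G ψ
  packingOn⇒packing P u v u≢v ψu≡ψv k k≤ here                         = u≢v refl
  packingOn⇒packing P u v u≢v ψu≡ψv k k≤ (step uv here)               = P .adjacent tt tt uv ψu≡ψv
  packingOn⇒packing {ψ} P u v u≢v ψu≡ψv k k≤ (step uw (step wv here)) =
    1+n≰n (subst (2 ≤_) (packSize-class₁ (P .distance2 tt tt uw wv u≢v ψu≡ψv)) k≤)
  packingOn⇒packing {ψ} P u v u≢v ψu≡ψv k k≤ (step _ (step _ (step _ _))) =
    3+m≰2 (≤-trans k≤ (packSize≤2 (ψ u)))
    where
    3+m≰2 : ∀ {m} → ¬ 3 + m ≤ 2
    3+m≰2 (s≤s (s≤s ()))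

  recolour : (V → Fin 9) → V → Fin 9 → V → Fin 9
  recolour ψ v k = updateAt ψ v (λ _ → k)

  recolour-view : ∀ ψ v k u → (u ≡ v × recolour ψ v k u ≡ k) ⊎ (u ≢ v × recolour ψ v k u ≡ ψ u)
  recolour-view ψ v k u with u ≟ v
  ... | yes refl = inj₁ (refl , updateAt-updates v ψ)
  ... | no u≢v   = inj₂ (u≢v , updateAt-minimal u v ψ u≢v)

  record FreeAt (D : Pred V 0ℓ) (ψ : V → Fin 9) (v : V) (k : Fin 9) : Set where
    field
      awayFromNeighbours : ∀ {u} → D u → Adj G v u → ψ u ≢ k
      awayFromDistance2  : Class₂ k → ∀ {u w} → D u → u ≢ v → Adj G v w → Adj G w u → ψ u ≢ k

  open FreeAt public

  free-class₁ : ∀ {D ψ v j} → Class₁ j → (∀ {u} → D u → Adj G v u → ψ u ≢ j) → FreeAt D ψ v j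
  free-class₁ j₁ away .awayFromNeighbours = away
  free-class₁ j₁ away .awayFromDistance2 j₂ = ⊥-elim (j₂ j₁)

  free-class₂ : ∀ {D ψ v k} → (∀ {u} → D u → u ≢ v → Near v u → ψ u ≢ k) → FreeAt D ψ v k
  free-class₂ away .awayFromNeighbours Du vu = away Du (≢-sym (Adj⇒≢ vu)) (inj₁ vu)
  free-class₂ away .awayFromDistance2 _ Du u≢v vw wu = away Du u≢v (inj₂ (_ , vw , wu))

  Clashes : Pred V 0ℓ → (V → Fin 9) → V → Fin 9 → Set
  Clashes D ψ v k = ∃ λ u → D u × u ≢ v × (Adj G v u ⊎ Class₂ k × Near v u) × ψ u ≡ k

  clashes? : ∀ {D} → Decidable D → ∀ ψ v k → Dec (Clashes D ψ v k)
  clashes? D? ψ v k = Finₚ.any? λ u →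
    D? u ×-dec ¬? (u ≟ v) ×-dec (Adj? v u ⊎-dec class₂? k ×-dec Near? v u) ×-dec (ψ u ≟ k)

  ¬clashes⇒free : ∀ {D ψ v k} → ¬ Clashes D ψ v k → FreeAt D ψ v k
  ¬clashes⇒free none .awayFromNeighbours Du vu ψu≡k = none (_ , Du , ≢-sym (Adj⇒≢ vu) , inj₁ vu , ψu≡k)
  ¬clashes⇒free none .awayFromDistance2 k₂ Du u≢v vw wu ψu≡k =
    none (_ , Du , u≢v , inj₂ (k₂ , inj₂ (_ , vw , wu)) , ψu≡k)

  ¬clashes-class₁ : ∀ {D ψ v j} → Class₁ j → ¬ (∃ λ u → D u × Adj G v u × ψ u ≡ j) → ¬ Clashes D ψ v j
  ¬clashes-class₁ j₁ none (u , Du , _ , inj₁ vu , ψu≡j)       = none (u , Du , vu , ψu≡j)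
  ¬clashes-class₁ j₁ none (_ , _ , _ , inj₂ (j₂ , _) , _)      = j₂ j₁

  ¬clashes-recolour : ∀ {D D′ ψ v w k k′} → ¬ Clashes D ψ v k → k′ ≢ k → (∀ {u} → D′ u → u ≢ w → D u)
                    → ¬ Clashes D′ (recolour ψ w k′) v k
  ¬clashes-recolour {ψ = ψ} {w = w} {k′ = k′} none k′≢k D′⊆D (u , D′u , u≢v , near , ψ′u≡k)
    with recolour-view ψ w k′ u
  ... | inj₁ (_ , ψ′u≡k′)  = k′≢k (trans (sym ψ′u≡k′) ψ′u≡k)
  ... | inj₂ (u≢w , ψ′u≡ψu) = none (u , D′⊆D D′u u≢w , u≢v , near , trans (sym ψ′u≡ψu) ψ′u≡k)

  free-class₂-colour : ∀ {D ψ v} → Decidable D → (R : List V)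
                     → (∀ {u} → D u → u ≢ v → Near v u → Class₂ (ψ u) → u ∈ R)
                     → (extra : List (Fin 9)) → length R + length extra ≤ 6
                     → ∃ λ k → Class₂ k × k ∉ extra × ¬ Clashes D ψ v k
  free-class₂-colour {D} {ψ} {v} D? R covers extra short
    with Any.any? (λ k → ¬? (k ∈? extra) ×-dec ¬? (clashes? D? ψ v k)) class₂Colours
  ... | yes found = let k , k∈ , k∉ , free = find found in k , ∈-class₂Colours⇒class₂ k∈ , k∉ , free
  ... | no none   = ⊥-elim (<⇒≱ (s≤s short)
    (subst (7 ≤_) (trans (length-++ extra) (trans (cong (length extra +_) (length-map ψ R)) (+-comm (length extra) (length R))))
      (Unique-⊆⇒length≤ class₂Colours-unique taken)))
    where
    taken : ∀ {k} → k ∈ class₂Colours → k ∈ extra ++ map ψ R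
    taken {k} k∈ with k ∈? extra
    ... | yes k∈extra = ∈-++⁺ˡ k∈extra
    ... | no k∉extra with clashes? D? ψ v k
    ...   | yes (u , Du , u≢v , adj-or-near , ψu≡k) =
      ∈-++⁺ʳ extra (subst (_∈ map ψ R) ψu≡k (∈-map⁺ ψ (covers Du u≢v (near adj-or-near)
        (subst Class₂ (sym ψu≡k) (∈-class₂Colours⇒class₂ k∈)))))
      where
      near : Adj G v u ⊎ Class₂ k × Near v u → Near v u
      near (inj₁ vu)          = inj₁ vu
      near (inj₂ (_ , v-u))   = v-u
    ...   | no free = ⊥-elim (none (lose k∈ (k∉extra , free)))

  recolour-packingOn : ∀ {D D′ ψ v k} → IsPackingOn D ψ → FreeAt D ψ v k → (∀ {u} → D′ u → u ≢ v → D u)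
                     → IsPackingOn D′ (recolour ψ v k)
  recolour-packingOn {ψ = ψ} {v} {k} P free D′⊆D .adjacent {u} {y} Du Dy uy eq
    with recolour-view ψ v k u | recolour-view ψ v k y
  ... | inj₁ (refl , e₁) | inj₁ (refl , e₂) = Adj-irrefl uy
  ... | inj₁ (refl , e₁) | inj₂ (y≢v , e₂) =
    free .awayFromNeighbours (D′⊆D Dy y≢v) uy (trans (sym e₂) (trans (sym eq) e₁))
  ... | inj₂ (u≢v , e₁) | inj₁ (refl , e₂) =
    free .awayFromNeighbours (D′⊆D Du u≢v) (Adj-sym uy) (trans (sym e₁) (trans eq e₂))
  ... | inj₂ (u≢v , e₁) | inj₂ (y≢v , e₂) =
    P .adjacent (D′⊆D Du u≢v) (D′⊆D Dy y≢v) uy (trans (sym e₁) (trans eq e₂))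
  recolour-packingOn {ψ = ψ} {v} {k} P free D′⊆D .distance2 {u} {w} {y} Du Dy uw wy u≢y eq
    with recolour-view ψ v k u | recolour-view ψ v k y | class₁? k
  ... | inj₁ (refl , e₁) | inj₁ (refl , e₂) | _     = ⊥-elim (u≢y refl)
  ... | inj₁ (_ , e₁)    | _                | yes k₁ = subst Class₁ (sym e₁) k₁
  ... | inj₂ (_ , e₁)    | inj₁ (_ , e₂)    | yes k₁ = subst Class₁ (sym (trans eq e₂)) k₁
  ... | inj₁ (refl , e₁) | inj₂ (y≢v , e₂)  | no k₂  =
    ⊥-elim (free .awayFromDistance2 k₂ (D′⊆D Dy y≢v) y≢v uw wy (trans (sym e₂) (trans (sym eq) e₁)))
  ... | inj₂ (u≢v , e₁)  | inj₁ (refl , e₂) | no k₂  =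
    ⊥-elim (free .awayFromDistance2 k₂ (D′⊆D Du u≢v) u≢v (Adj-sym wy) (Adj-sym uw) (trans (sym e₁) (trans eq e₂)))
  ... | inj₂ (u≢v , e₁)  | inj₂ (y≢v , e₂)  | _      =
    subst Class₁ (sym e₁) (P .distance2 (D′⊆D Du u≢v) (D′⊆D Dy y≢v) uw wy u≢y (trans (sym e₁) (trans eq e₂)))

  Tidy : Pred V 0ℓ → (V → Fin 9) → Set
  Tidy D ψ = ∀ {w} → D w → Class₂ (ψ w) → ∀ {j} → Class₁ j → ∃ λ u → D u × Adj G w u × ψ u ≡ j

  module _ {D : Pred V 0ℓ} (D? : Decidable D) where

    private
      colouredNeighbour? : (ψ : V → Fin 9) (w : V) (j : Fin 9) → Dec (∃ λ u → D u × Adj G w u × ψ u ≡ j)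
      colouredNeighbour? ψ w j = Finₚ.any? (λ u → D? u ×-dec Adj? w u ×-dec (ψ u ≟ j))

      Untidy : (V → Fin 9) → Set
      Untidy ψ = ∃ λ w → ∃ λ j → D w × Class₂ (ψ w) × Class₁ j × ¬ (∃ λ u → D u × Adj G w u × ψ u ≡ j)

      untidy? : (ψ : V → Fin 9) → Dec (Untidy ψ)
      untidy? ψ = Finₚ.any? λ (w : V) → Finₚ.any? λ (j : Fin 9) →
        D? w ×-dec ¬? (class₁? (ψ w)) ×-dec class₁? j ×-dec ¬? (colouredNeighbour? ψ w j)

      class₂In? : (ψ : V → Fin 9) → Decidable (λ w → D w × Class₂ (ψ w))
      class₂In? ψ w = D? w ×-dec ¬? (class₁? (ψ w))

      class₂Count : (V → Fin 9) → ℕ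
      class₂Count ψ = length (filter (class₂In? ψ) (allFin (n G)))

      class₂Count-decreases : (ψ : V → Fin 9) {w : V} {j : Fin 9} → D w → Class₂ (ψ w) → Class₁ j
                            → class₂Count (recolour ψ w j) < class₂Count ψ
      class₂Count-decreases ψ {w} {j} Dw w₂ j₁ =
        length-filter-mono-< (class₂In? (recolour ψ w j)) (class₂In? ψ) fewer (allFin (n G)) (∈-allFin w)
          (λ (_ , w₂′) → w₂′ recoloured) (Dw , w₂)
        where
        recoloured : Class₁ (recolour ψ w j w)
        recoloured = subst Class₁ (sym (updateAt-updates w ψ)) j₁
        fewer : ∀ {u} → D u × Class₂ (recolour ψ w j u) → D u × Class₂ (ψ u)
        fewer {u} (Du , u₂) with recolour-view ψ w j u
        ... | inj₁ (refl , _) = ⊥-elim (u₂ recoloured)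
        ... | inj₂ (_ , e)    = Du , subst Class₂ e u₂

      tidy-acc : ∀ {ψ} → Acc _<_ (class₂Count ψ) → IsPackingOn D ψ → ∃ λ ψ′ → IsPackingOn D ψ′ × Tidy D ψ′
      tidy-acc {ψ} (acc smaller) P with untidy? ψ
      ... | yes (w , j , Dw , w₂ , j₁ , absent) =
        tidy-acc (smaller (class₂Count-decreases ψ Dw w₂ j₁))
          (recolour-packingOn P (free-class₁ j₁ λ Du wu ψu≡j → absent (_ , Du , wu , ψu≡j)) λ Du _ → Du)
      ... | no tidy = ψ , P , present
        where
        present : Tidy D ψ
        present {w} Dw w₂ {j} j₁ with colouredNeighbour? ψ w j
        ... | yes found  = found
        ... | no absent  = ⊥-elim (tidy (w , j , Dw , w₂ , j₁ , absent))

    tidy : ∀ {ψ} → IsPackingOn D ψ → ∃ λ ψ′ → IsPackingOn D ψ′ × Tidy D ψ′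
    tidy = tidy-acc (<-wellFounded _)

module _ (G : Graph) (a b : Fin (n G)) where

  open GraphProperties G
  open Packing G
  open RemoveEdge G a b
  private
    module H = GraphProperties (removeEdge G a b)
    module PH = Packing (removeEdge G a b)

  removeEdge-packingOn-off : ∀ {φ} → IsPacking1²2⁷Coloring (removeEdge G a b) φ
                           → IsPackingOn (λ u → u ≢ a × u ≢ b) φ
  removeEdge-packingOn-off packing .adjacent (u≢a , u≢b) _ uv =
    PH.adjacent (PH.packing⇒packingOn packing) tt tt (Adj-removeEdge⁺ˡ uv u≢a u≢b)
  removeEdge-packingOn-off packing .distance2 (u≢a , u≢b) (v≢a , v≢b) uw wv =
    PH.distance2 (PH.packing⇒packingOn packing) tt tt
      (Adj-removeEdge⁺ˡ uw u≢a u≢b) (H.Adj-sym (Adj-removeEdge⁺ˡ (Adj-sym wv) v≢a v≢b))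

-- Case d ≠ e: the fan around b

data Shade : Set where
  colour0 colour1 class2 : Shade

_≟ˢ_ : DecidableEquality Shade
colour0 ≟ˢ colour0 = yes refl
colour0 ≟ˢ colour1 = no λ ()
colour0 ≟ˢ class2  = no λ ()
colour1 ≟ˢ colour0 = no λ ()
colour1 ≟ˢ colour1 = yes refl
colour1 ≟ˢ class2  = no λ ()
class2  ≟ˢ colour0 = no λ ()
class2  ≟ˢ colour1 = no λ ()
class2  ≟ˢ class2  = yes refl

shade : Fin 9 → Shade
shade zero          = colour0
shade (suc zero)    = colour1
shade (suc (suc _)) = class2

data Spoke : Set where
  sa sc sd se : Spoke

spokes : List Spoke
spokes = sa ∷ sc ∷ sd ∷ se ∷ []

∈-spokes : ∀ i → i ∈ spokes
∈-spokes sa = here refl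
∈-spokes sc = there (here refl)
∈-spokes sd = there (there (here refl))
∈-spokes se = there (there (there (here refl)))

record OptionalEdges : Set where
  constructor optionalEdges
  field
    edge-ae edge-cd edge-de : Bool

open OptionalEdges public

spokeAdj : OptionalEdges → Spoke → Spoke → Bool
spokeAdj f sa sa = false
spokeAdj f sa sc = true
spokeAdj f sa sd = true
spokeAdj f sa se = edge-ae f
spokeAdj f sc sa = true
spokeAdj f sc sc = false
spokeAdj f sc sd = edge-cd f
spokeAdj f sc se = true
spokeAdj f sd sa = true
spokeAdj f sd sc = edge-cd f
spokeAdj f sd sd = false
spokeAdj f sd se = edge-de f
spokeAdj f se sa = edge-ae f
spokeAdj f se sc = true
spokeAdj f se sd = edge-de f
spokeAdj f se se = false

shading : Shade → Shade → Shade → Shade → Spoke → Shade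
shading x y z w sa = x
shading x y z w sc = y
shading x y z w sd = z
shading x y z w se = w

bit : Bool → ℕ
bit true  = 1
bit false = 0

sumSpokes : (Spoke → ℕ) → ℕ
sumSpokes g = g sa + (g sc + (g sd + g se))

Absent : (Spoke → Shade) → OptionalEdges → Spoke → Shade → Set
Absent s f y k = All (λ x → spokeAdj f y x ≡ true → s x ≢ k) spokes

absent? : ∀ s f y k → Dec (Absent s f y k)
absent? s f y k = All.all? (λ x → (spokeAdj f y x Boolₚ.≟ true) →-dec ¬? (s x ≟ˢ k)) spokes

-- With the hub b uncoloured and the colouring tidy, the block of spoke y (y together with its neighbours
-- outside a, b, c, d, e) contains at least `demand` class-1 vertices and at most `suc (4 ∸ coreDegree)`
-- vertices in all.
demand : (Spoke → Shade) → OptionalEdges → Spoke → ℕ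
demand s f y =
  if does (s y ≟ˢ class2)
  then bit (does (absent? s f y colour0)) + bit (does (absent? s f y colour1))
  else 1

totalDemand : (Spoke → Shade) → OptionalEdges → ℕ
totalDemand s f = sumSpokes (demand s f)

coreDegree : OptionalEdges → Spoke → ℕ
coreDegree f y = bit (spokeAdj f y sa) + (1 + (bit (spokeAdj f y sc) + (bit (spokeAdj f y sd) + (bit (spokeAdj f y se) + 0))))

capacity : OptionalEdges → ℕ
capacity f = sumSpokes (λ y → suc (4 ∸ coreDegree f y))

Admissible : (Spoke → Shade) → OptionalEdges → Set
Admissible s f = colour0 ∈ map s spokes × colour1 ∈ map s spokes
               × All (λ i → All (λ j → spokeAdj f i j ≡ true → s i ≢ class2 → s i ≢ s j) spokes) spokes

-- The configurations that the count does not exclude; `SwapAtA` is the reflection a ↔ c, d ↔ e.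
SwapAtC : (Spoke → Shade) → OptionalEdges → Set
SwapAtC s f = s sc ≡ class2 × s sa ≢ class2 × s se ≢ class2 × s sa ≢ s se × (s sd ≡ class2 ⊎ s sd ≡ s se)
            × edge-ae f ≡ false × edge-cd f ≡ false × edge-de f ≡ false

SwapAtA : (Spoke → Shade) → OptionalEdges → Set
SwapAtA s f = s sa ≡ class2 × s sc ≢ class2 × s sd ≢ class2 × s sc ≢ s sd × (s se ≡ class2 ⊎ s se ≡ s sd)
            × edge-cd f ≡ false × edge-ae f ≡ false × edge-de f ≡ false

FanCheck : (Spoke → Shade) → OptionalEdges → Set
FanCheck s f = (Admissible s f → capacity f < 7 + totalDemand s f ⊎ SwapAtC s f ⊎ SwapAtA s f)
             × (SwapAtC s f → capacity f < 8 + totalDemand s f × demand s f sc ≡ 0 × demand s f se ≡ 1)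

fanCheck? : ∀ s f → Dec (FanCheck s f)
fanCheck? s f =
  (admissible? →-dec ((capacity f <? 7 + totalDemand s f) ⊎-dec swapAtC? ⊎-dec swapAtA?))
  ×-dec (swapAtC? →-dec ((capacity f <? 8 + totalDemand s f)
                          ×-dec (demand s f sc ℕ.≟ 0) ×-dec (demand s f se ℕ.≟ 1)))
  where
  admissible? : Dec (Admissible s f)
  admissible? = Any.any? (colour0 ≟ˢ_) (map s spokes) ×-dec Any.any? (colour1 ≟ˢ_) (map s spokes)
    ×-dec All.all? (λ i → All.all? (λ j →
            (spokeAdj f i j Boolₚ.≟ true) →-dec ¬? (s i ≟ˢ class2) →-dec ¬? (s i ≟ˢ s j)) spokes) spokes
  swapAtC? : Dec (SwapAtC s f)
  swapAtC? = (s sc ≟ˢ class2) ×-dec ¬? (s sa ≟ˢ class2) ×-dec ¬? (s se ≟ˢ class2) ×-dec ¬? (s sa ≟ˢ s se)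
    ×-dec ((s sd ≟ˢ class2) ⊎-dec (s sd ≟ˢ s se))
    ×-dec (edge-ae f Boolₚ.≟ false) ×-dec (edge-cd f Boolₚ.≟ false) ×-dec (edge-de f Boolₚ.≟ false)
  swapAtA? : Dec (SwapAtA s f)
  swapAtA? = (s sa ≟ˢ class2) ×-dec ¬? (s sc ≟ˢ class2) ×-dec ¬? (s sd ≟ˢ class2) ×-dec ¬? (s sc ≟ˢ s sd)
    ×-dec ((s se ≟ˢ class2) ⊎-dec (s se ≟ˢ s sd))
    ×-dec (edge-cd f Boolₚ.≟ false) ×-dec (edge-ae f Boolₚ.≟ false) ×-dec (edge-de f Boolₚ.≟ false)

allShades : List Shade
allShades = colour0 ∷ colour1 ∷ class2 ∷ []

∈-allShades : ∀ x → x ∈ allShades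
∈-allShades colour0 = here refl
∈-allShades colour1 = there (here refl)
∈-allShades class2  = there (there (here refl))

allBools : List Bool
allBools = true ∷ false ∷ []

∈-allBools : ∀ p → p ∈ allBools
∈-allBools true  = here refl
∈-allBools false = there (here refl)

AllConfigurations : Set
AllConfigurations =
  All (λ x → All (λ y → All (λ z → All (λ w → All (λ p → All (λ q → All (λ r →
    FanCheck (shading x y z w) (optionalEdges p q r)) allBools) allBools) allBools) allShades) allShades) allShades) allShades

allConfigurations? : Dec AllConfigurations
allConfigurations? =
  All.all? (λ x → All.all? (λ y → All.all? (λ z → All.all? (λ w → All.all? (λ p → All.all? (λ q → All.all? (λ r →
    fanCheck? (shading x y z w) (optionalEdges p q r)) allBools) allBools) allBools) allShades) allShades) allShades) allShades

-- Established by evaluating `allConfigurations?`; opaque so that uses never unfold the table.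
opaque
  fanCheck : ∀ x y z w f → FanCheck (shading x y z w) f
  fanCheck x y z w f =
    All.lookup (All.lookup (All.lookup (All.lookup (All.lookup (All.lookup (All.lookup allConfigurations
      (∈-allShades x)) (∈-allShades y)) (∈-allShades z)) (∈-allShades w))
      (∈-allBools (edge-ae f))) (∈-allBools (edge-cd f))) (∈-allBools (edge-de f))
    where
    allConfigurations : AllConfigurations
    allConfigurations = toWitness {a? = allConfigurations?} tt

sumSpokes-mono : ∀ {g h} → (∀ i → g i ≤ h i) → sumSpokes g ≤ sumSpokes h
sumSpokes-mono g≤h = +-mono-≤ (g≤h sa) (+-mono-≤ (g≤h sc) (+-mono-≤ (g≤h sd) (g≤h se)))

sumSpokes-mono-< : ∀ {g h} → (∀ i → g i ≤ h i) → ∀ i → g i < h i → sumSpokes g < sumSpokes h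
sumSpokes-mono-< g≤h sa lt = +-mono-<-≤ lt (+-mono-≤ (g≤h sc) (+-mono-≤ (g≤h sd) (g≤h se)))
sumSpokes-mono-< g≤h sc lt = +-mono-≤-< (g≤h sa) (+-mono-<-≤ lt (+-mono-≤ (g≤h sd) (g≤h se)))
sumSpokes-mono-< g≤h sd lt = +-mono-≤-< (g≤h sa) (+-mono-≤-< (g≤h sc) (+-mono-<-≤ lt (g≤h se)))
sumSpokes-mono-< g≤h se lt = +-mono-≤-< (g≤h sa) (+-mono-≤-< (g≤h sc) (+-mono-≤-< (g≤h sd) lt))

bit-does+bit-does≤ : ∀ {A B : Set} {m} (A? : Dec A) (B? : Dec B)
                   → (A → 1 ≤ m) → (B → 1 ≤ m) → (A → B → 2 ≤ m) → bit (does A?) + bit (does B?) ≤ m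
bit-does+bit-does≤ (yes a) (yes b) _   _   both = both a b
bit-does+bit-does≤ (yes a) (no _)  one _   _    = one a
bit-does+bit-does≤ (no _)  (yes b) _   one _    = one b
bit-does+bit-does≤ (no _)  (no _)  _   _   _    = z≤n

module _ {A : Set} where

  concatSpokes : (Spoke → List A) → List A
  concatSpokes g = g sa ++ (g sc ++ (g sd ++ g se))

  ∈-concatSpokes⁺ : ∀ g {x} i → x ∈ g i → x ∈ concatSpokes g
  ∈-concatSpokes⁺ g sa x∈ = ∈-++⁺ˡ x∈
  ∈-concatSpokes⁺ g sc x∈ = ∈-++⁺ʳ (g sa) (∈-++⁺ˡ x∈)
  ∈-concatSpokes⁺ g sd x∈ = ∈-++⁺ʳ (g sa) (∈-++⁺ʳ (g sc) (∈-++⁺ˡ x∈))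
  ∈-concatSpokes⁺ g se x∈ = ∈-++⁺ʳ (g sa) (∈-++⁺ʳ (g sc) (∈-++⁺ʳ (g sd) x∈))

  length-concatSpokes : ∀ g → length (concatSpokes g) ≡ sumSpokes (length ∘ g)
  length-concatSpokes g =
    trans (length-++ (g sa)) (cong (length (g sa) +_)
      (trans (length-++ (g sc)) (cong (length (g sc) +_) (length-++ (g sd)))))

  #₁-concatSpokes : ∀ (ψ : A → Fin 9) g → #₁ ψ (concatSpokes g) ≡ sumSpokes (#₁ ψ ∘ g)
  #₁-concatSpokes ψ g =
    trans (#₁-++ ψ (g sa) _) (cong (#₁ ψ (g sa) +_) (trans (#₁-++ ψ (g sc) _) (cong (#₁ ψ (g sc) +_) (#₁-++ ψ (g sd) _))))

shade≡class2⇒class₂ : ∀ {c} → shade c ≡ class2 → Class₂ c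
shade≡class2⇒class₂ {suc (suc _)} _ ()

shade≢class2⇒class₁ : ∀ {c} → shade c ≢ class2 → Class₁ c
shade≢class2⇒class₁ {zero}          _   = first
shade≢class2⇒class₁ {suc zero}      _   = second
shade≢class2⇒class₁ {suc (suc _)} c≢2 = ⊥-elim (c≢2 refl)

shade-injective₁ : ∀ {x y} → shade x ≢ class2 → shade x ≡ shade y → x ≡ y
shade-injective₁ {zero}       {zero}           _   _  = refl
shade-injective₁ {suc zero}   {suc zero}       _   _  = refl
shade-injective₁ {suc (suc _)} {_}             x≢2 _  = ⊥-elim (x≢2 refl)
shade-injective₁ {zero}       {suc zero}       _   ()
shade-injective₁ {zero}       {suc (suc _)}    _   ()
shade-injective₁ {suc zero}   {zero}           _   ()
shade-injective₁ {suc zero}   {suc (suc _)}    _   ()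

module FanCase (G : Graph) (Δ≤4 : MaxDegreeAtMost G 4) where

  open GraphProperties G
  open Packing G

  record Fan : Set where
    field
      a b c d e : V
      ab : Adj G a b
      ac : Adj G a c
      bc : Adj G b c
      ad : Adj G a d
      bd : Adj G b d
      be : Adj G b e
      ce : Adj G c e
      d≢c : d ≢ c
      e≢a : e ≢ a
      d≢e : d ≢ e

  mirror : Fan → Fan
  mirror F = record
    { a = c ; b = b ; c = a ; d = e ; e = d
    ; ab = Adj-sym bc ; ac = Adj-sym ac ; bc = Adj-sym ab ; ad = ce ; bd = be ; be = bd ; ce = ad
    ; d≢c = e≢a ; e≢a = d≢c ; d≢e = ≢-sym d≢e }
    where open Fan F

  module FanProperties (F : Fan) where

    open Fan F public

    a≢b : a ≢ b
    a≢b = Adj⇒≢ ab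
    a≢c : a ≢ c
    a≢c = Adj⇒≢ ac
    a≢d : a ≢ d
    a≢d = Adj⇒≢ ad
    a≢e : a ≢ e
    a≢e = ≢-sym e≢a
    b≢c : b ≢ c
    b≢c = Adj⇒≢ bc
    b≢d : b ≢ d
    b≢d = Adj⇒≢ bd
    b≢e : b ≢ e
    b≢e = Adj⇒≢ be
    c≢d : c ≢ d
    c≢d = ≢-sym d≢c
    c≢e : c ≢ e
    c≢e = Adj⇒≢ ce
    c≢a : c ≢ a
    c≢a = ≢-sym a≢c
    d≢a : d ≢ a
    d≢a = ≢-sym a≢d
    c≢b : c ≢ b
    c≢b = ≢-sym b≢c
    d≢b : d ≢ b
    d≢b = ≢-sym b≢d
    e≢b : e ≢ b
    e≢b = ≢-sym b≢e

    spoke : Spoke → V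
    spoke sa = a
    spoke sc = c
    spoke sd = d
    spoke se = e

    hub-spoke : ∀ i → Adj G b (spoke i)
    hub-spoke sa = Adj-sym ab
    hub-spoke sc = bc
    hub-spoke sd = bd
    hub-spoke se = be

    spoke≢hub : ∀ i → spoke i ≢ b
    spoke≢hub i = ≢-sym (Adj⇒≢ (hub-spoke i))

    core : List V
    core = a ∷ b ∷ c ∷ d ∷ e ∷ []

    core-unique : Unique core
    core-unique =
      (a≢b ∷ a≢c ∷ a≢d ∷ a≢e ∷ []) ∷ (b≢c ∷ b≢d ∷ b≢e ∷ []) ∷ (c≢d ∷ c≢e ∷ []) ∷ (d≢e ∷ []) ∷ [] ∷ []

    spoke-or-outside : ∀ u → u ≢ b → (∃ λ i → u ≡ spoke i) ⊎ u ∉ core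
    spoke-or-outside u u≢b with u ≟ a | u ≟ c | u ≟ d | u ≟ e
    ... | yes u≡a | _       | _       | _       = inj₁ (sa , u≡a)
    ... | no _    | yes u≡c | _       | _       = inj₁ (sc , u≡c)
    ... | no _    | no _    | yes u≡d | _       = inj₁ (sd , u≡d)
    ... | no _    | no _    | no _    | yes u≡e = inj₁ (se , u≡e)
    ... | no u≢a  | no u≢c  | no u≢d  | no u≢e  = inj₂ λ
      { (here u≡a) → u≢a u≡a
      ; (there (here u≡b)) → u≢b u≡b
      ; (there (there (here u≡c))) → u≢c u≡c
      ; (there (there (there (here u≡d)))) → u≢d u≡d
      ; (there (there (there (there (here u≡e))))) → u≢e u≡e }

    ∉core⇒≢ : ∀ {u x} → u ∉ core → x ∈ core → x ≢ u
    ∉core⇒≢ u∉core x∈core refl = u∉core x∈core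

    hub-neighbour : ∀ {u} → Adj G b u → ∃ λ i → u ≡ spoke i
    hub-neighbour {u} bu with spoke-or-outside u (≢-sym (Adj⇒≢ bu))
    ... | inj₁ found   = found
    ... | inj₂ u∉core  = ⊥-elim (1+n≰n (≤-trans (length≤degree five-distinct five-adjacent) (Δ≤4 b)))
      where
      ≢u : ∀ {x} → x ∈ core → x ≢ u
      ≢u = ∉core⇒≢ u∉core
      five-distinct : Unique (a ∷ c ∷ d ∷ e ∷ u ∷ [])
      five-distinct = (a≢c ∷ a≢d ∷ a≢e ∷ ≢u (here refl) ∷ []) ∷ (c≢d ∷ c≢e ∷ ≢u (there (there (here refl))) ∷ [])
        ∷ (d≢e ∷ ≢u (there (there (there (here refl)))) ∷ []) ∷ (≢u (there (there (there (there (here refl))))) ∷ [])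
        ∷ [] ∷ []
      five-adjacent : All (Adj G b) (a ∷ c ∷ d ∷ e ∷ u ∷ [])
      five-adjacent = Adj-sym ab ∷ bc ∷ bd ∷ be ∷ bu ∷ []

    edges : OptionalEdges
    edges = optionalEdges (adj G a e) (adj G c d) (adj G d e)

    spokeAdj-correct : ∀ i j → adj G (spoke i) (spoke j) ≡ spokeAdj edges i j
    spokeAdj-correct sa sa = irrfl G a
    spokeAdj-correct sa sc = ac
    spokeAdj-correct sa sd = ad
    spokeAdj-correct sa se = refl
    spokeAdj-correct sc sa = Adj-sym ac
    spokeAdj-correct sc sc = irrfl G c
    spokeAdj-correct sc sd = refl
    spokeAdj-correct sc se = ce
    spokeAdj-correct sd sa = Adj-sym ad
    spokeAdj-correct sd sc = Graph.sym G d c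
    spokeAdj-correct sd sd = irrfl G d
    spokeAdj-correct sd se = refl
    spokeAdj-correct se sa = Graph.sym G e a
    spokeAdj-correct se sc = Adj-sym ce
    spokeAdj-correct se sd = Graph.sym G e d
    spokeAdj-correct se se = irrfl G e

    open Outside G core public

    length-filter-Adj : ∀ y xs → length (filter (Adj? y) xs) ≡ sum (map (λ x → bit (adj G y x)) xs)
    length-filter-Adj y []       = refl
    length-filter-Adj y (x ∷ xs) with adj G y x
    ... | true  = cong suc (length-filter-Adj y xs)
    ... | false = length-filter-Adj y xs

    core-degree : ∀ i → length (filter (Adj? (spoke i)) core) ≡ coreDegree edges i
    core-degree i
      rewrite length-filter-Adj (spoke i) core
            | spokeAdj-correct i sa | spokeAdj-correct i sc | spokeAdj-correct i sd | spokeAdj-correct i se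
            | Adj-sym (hub-spoke i) = refl

    outer-length : ∀ i → length (outer (spoke i)) ≤ 4 ∸ coreDegree edges i
    outer-length i = subst (λ m → length (outer y) ≤ 4 ∸ m) (core-degree i)
      (m+n≤o⇒m≤o∸n _ (≤-trans (length-outer++≤degree y (Uniqueₚ.filter⁺ (Adj? y) core-unique) in-core neighbours)
                               (Δ≤4 y)))
      where
      y : V
      y = spoke i
      in-core : All (_∈ core) (filter (Adj? y) core)
      in-core = All.tabulate λ v∈ → proj₁ (∈-filter⁻ (Adj? y) {xs = core} v∈)
      neighbours : All (Adj G y) (filter (Adj? y) core)
      neighbours = All.tabulate λ v∈ → proj₂ (∈-filter⁻ (Adj? y) {xs = core} v∈)

    block : Spoke → List V
    block i = spoke i ∷ outer (spoke i)

    ball : List V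
    ball = concatSpokes block

    length-ball : length ball ≤ capacity edges
    length-ball = subst (_≤ capacity edges) (sym (length-concatSpokes block))
      (sumSpokes-mono λ i → s≤s (outer-length i))

    near-hub⇒∈ball : ∀ {u} → u ≢ b → Near b u → u ∈ ball
    near-hub⇒∈ball u≢b (inj₁ bu) with hub-neighbour bu
    ... | i , refl = ∈-concatSpokes⁺ block i (here refl)
    near-hub⇒∈ball {u} u≢b (inj₂ (w , bw , wu)) with hub-neighbour bw | spoke-or-outside u u≢b
    ... | _ , _    | inj₁ (j , refl) = ∈-concatSpokes⁺ block j (here refl)
    ... | i , refl | inj₂ u∉core     = ∈-concatSpokes⁺ block i (there (∈-outer⁺ wu u∉core))

    private
      module H = GraphProperties (removeEdge G a b)
      module PH = Packing (removeEdge G a b)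
      open RemoveEdge G a b

      ca : Adj (removeEdge G a b) c a
      ca = Adj-removeEdge⁺ˡ (Adj-sym ac) c≢a c≢b
      da : Adj (removeEdge G a b) d a
      da = Adj-removeEdge⁺ˡ (Adj-sym ad) d≢a d≢b
      ce′ : Adj (removeEdge G a b) c e
      ce′ = Adj-removeEdge⁺ˡ ce c≢a c≢b
      cb : Adj (removeEdge G a b) c b
      cb = Adj-removeEdge⁺ˡ (Adj-sym bc) c≢a c≢b
      db : Adj (removeEdge G a b) d b
      db = Adj-removeEdge⁺ˡ (Adj-sym bd) d≢a d≢b
      eb : Adj (removeEdge G a b) e b
      eb = Adj-removeEdge⁺ˡ (Adj-sym be) e≢a e≢b

      spokes-near-without-ab : ∀ i j → spoke i ≢ spoke j → H.Near (spoke i) (spoke j)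
      spokes-near-without-ab sa sc _ = inj₁ (H.Adj-sym ca)
      spokes-near-without-ab sa sd _ = inj₁ (H.Adj-sym da)
      spokes-near-without-ab sa se _ = inj₂ (c , H.Adj-sym ca , ce′)
      spokes-near-without-ab sc sa _ = inj₁ ca
      spokes-near-without-ab sc sd _ = inj₂ (b , cb , H.Adj-sym db)
      spokes-near-without-ab sc se _ = inj₁ ce′
      spokes-near-without-ab sd sa _ = inj₁ da
      spokes-near-without-ab sd sc _ = inj₂ (b , db , H.Adj-sym cb)
      spokes-near-without-ab sd se _ = inj₂ (b , db , H.Adj-sym eb)
      spokes-near-without-ab se sa _ = inj₂ (c , H.Adj-sym ce′ , ca)
      spokes-near-without-ab se sc _ = inj₁ (H.Adj-sym ce′)
      spokes-near-without-ab se sd _ = inj₂ (b , eb , H.Adj-sym db)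
      spokes-near-without-ab sa sa a≢a = ⊥-elim (a≢a refl)
      spokes-near-without-ab sc sc c≢c = ⊥-elim (c≢c refl)
      spokes-near-without-ab sd sd d≢d = ⊥-elim (d≢d refl)
      spokes-near-without-ab se se e≢e = ⊥-elim (e≢e refl)

    removeEdge-packingOn : ∀ {φ} → IsPacking1²2⁷Coloring (removeEdge G a b) φ → IsPackingOn (_≢ b) φ
    removeEdge-packingOn packing .adjacent u≢b v≢b uv =
      PH.adjacent (PH.packing⇒packingOn packing) tt tt (Adj-removeEdge⁺-≢b uv u≢b v≢b)
    removeEdge-packingOn packing .distance2 {u} {w} {v} u≢b v≢b uw wv u≢v φu≡φv with w ≟ b
    ... | no w≢b = PH.distance2 (PH.packing⇒packingOn packing) tt tt
                     (Adj-removeEdge⁺-≢b uw u≢b w≢b) (Adj-removeEdge⁺-≢b wv w≢b v≢b) u≢v φu≡φv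
    ... | yes refl with hub-neighbour (Adj-sym uw) | hub-neighbour wv
    ...   | i , refl | j , refl with spokes-near-without-ab i j u≢v
    ...     | inj₁ ij            = ⊥-elim (PH.adjacent (PH.packing⇒packingOn packing) tt tt ij φu≡φv)
    ...     | inj₂ (x , ix , xj) = PH.distance2 (PH.packing⇒packingOn packing) tt tt ix xj u≢v φu≡φv

  module FanColouring (F : Fan) {ψ : V → Fin 9}
                      (P : IsPackingOn (_≢ Fan.b F) ψ) (T : Tidy (_≢ Fan.b F) ψ) where

    open FanProperties F

    Saturated : Set
    Saturated = ∀ k → Clashes (_≢ b) ψ b k

    saturated-class₁ : Saturated → ∀ {j} → Class₁ j → ∃ λ u → Adj G b u × ψ u ≡ j
    saturated-class₁ sat {j} j₁ with sat j
    ... | u , _ , _ , inj₁ bu , ψu≡j = u , bu , ψu≡j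
    ... | _ , _ , _ , inj₂ (j₂ , _) , _ = ⊥-elim (j₂ j₁)

    saturated-class₂ : Saturated → ∀ {k} → Class₂ k → ∃ λ u → u ≢ b × Near b u × ψ u ≡ k
    saturated-class₂ sat {k} _ with sat k
    ... | u , u≢b , _ , inj₁ bu , ψu≡k        = u , u≢b , inj₁ bu , ψu≡k
    ... | u , u≢b , _ , inj₂ (_ , near) , ψu≡k = u , u≢b , near , ψu≡k

    shades : Spoke → Shade
    shades = shading (shade (ψ a)) (shade (ψ c)) (shade (ψ d)) (shade (ψ e))

    shades-spoke : ∀ i → shades i ≡ shade (ψ (spoke i))
    shades-spoke sa = refl
    shades-spoke sc = refl
    shades-spoke sd = refl
    shades-spoke se = refl

    check : FanCheck shades edges
    check = fanCheck (shade (ψ a)) (shade (ψ c)) (shade (ψ d)) (shade (ψ e)) edges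

    admissible : Saturated → Admissible shades edges
    admissible sat = present first , present second , All.tabulate λ {i} _ → All.tabulate λ {j} _ → distinct i j
      where
      present : ∀ {j} → Class₁ j → shade j ∈ map shades spokes
      present j₁ with saturated-class₁ sat j₁
      ... | u , bu , refl with hub-neighbour bu
      ...   | i , refl = subst (_∈ map shades spokes) (shades-spoke i) (∈-map⁺ shades (∈-spokes i))
      distinct : ∀ i j → spokeAdj edges i j ≡ true → shades i ≢ class2 → shades i ≢ shades j
      distinct i j ij i≢2 i≡j =
        P .adjacent (spoke≢hub i) (spoke≢hub j) (trans (spokeAdj-correct i j) ij)
          (shade-injective₁ (subst (_≢ class2) (shades-spoke i) i≢2)
            (trans (sym (shades-spoke i)) (trans i≡j (shades-spoke j))))

    tidy-witness-outside : ∀ i → Class₂ (ψ (spoke i)) → ∀ {j} → Class₁ j → Absent shades edges i (shade j)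
                         → ∃ λ u → u ∈ outer (spoke i) × ψ u ≡ j
    tidy-witness-outside i i₂ j₁ absent with T (spoke≢hub i) i₂ j₁
    ... | u , u≢b , iu , ψu≡j with spoke-or-outside u u≢b
    ...   | inj₂ u∉core = u , ∈-outer⁺ iu u∉core , ψu≡j
    ...   | inj₁ (k , refl) =
      ⊥-elim (All.lookup absent (∈-spokes k) (trans (sym (spokeAdj-correct i k)) iu)
                (trans (shades-spoke k) (cong shade ψu≡j)))

    demand≤#₁ : ∀ i → demand shades edges i ≤ #₁ ψ (block i)
    demand≤#₁ i with shades i ≟ˢ class2
    ... | no i≢2 =
      ∈⇒1≤length-filter (class₁? ∘ ψ) (here refl) (shade≢class2⇒class₁ (subst (_≢ class2) (shades-spoke i) i≢2))
    ... | yes i≡2 =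
      bit-does+bit-does≤ (absent? shades edges i colour0) (absent? shades edges i colour1)
        (λ absent₀ → let u , u∈ , ψu≡0 = witness first absent₀ in one-more u∈ ψu≡0 first)
        (λ absent₁ → let v , v∈ , ψv≡1 = witness second absent₁ in one-more v∈ ψv≡1 second)
        λ absent₀ absent₁ →
          let u , u∈ , ψu≡0 = witness first absent₀
              v , v∈ , ψv≡1 = witness second absent₁
          in ∈⇒2≤length-filter (class₁? ∘ ψ) (there u∈) (there v∈) (colour-≢⇒≢ ψ ψu≡0 ψv≡1 0≢1)
               (subst Class₁ (sym ψu≡0) first) (subst Class₁ (sym ψv≡1) second)
      where
      witness : ∀ {j} → Class₁ j → Absent shades edges i (shade j) → ∃ λ u → u ∈ outer (spoke i) × ψ u ≡ j
      witness = tidy-witness-outside i (shade≡class2⇒class₂ (trans (sym (shades-spoke i)) i≡2))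
      one-more : ∀ {u j} → u ∈ outer (spoke i) → ψ u ≡ j → Class₁ j → 1 ≤ #₁ ψ (block i)
      one-more u∈ ψu≡j j₁ = ∈⇒1≤length-filter (class₁? ∘ ψ) (there u∈) (subst Class₁ (sym ψu≡j) j₁)

    totalDemand≤#₁ : totalDemand shades edges ≤ #₁ ψ ball
    totalDemand≤#₁ = subst (totalDemand shades edges ≤_) (sym (#₁-concatSpokes ψ block)) (sumSpokes-mono demand≤#₁)

    7≤#₂-ball : Saturated → 7 ≤ #₂ ψ ball
    7≤#₂-ball sat = 7≤#₂ ψ λ k₂ →
      let u , u≢b , near , ψu≡k = saturated-class₂ sat k₂ in u , near-hub⇒∈ball u≢b near , ψu≡k

    within-budget : ∀ {m₁ m₂} → m₁ ≤ #₁ ψ ball → m₂ ≤ #₂ ψ ball → m₁ + m₂ ≤ capacity edges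
    within-budget m₁≤ m₂≤ =
      ≤-trans (+-mono-≤ m₁≤ m₂≤) (subst (_≤ capacity edges) (sym (#₁+#₂≡length ψ ball)) length-ball)

    capacity≮7+totalDemand : Saturated → ¬ capacity edges < 7 + totalDemand shades edges
    capacity≮7+totalDemand sat tight =
      <⇒≱ tight (subst (_≤ capacity edges) (+-comm (totalDemand shades edges) 7)
                  (within-budget totalDemand≤#₁ (7≤#₂-ball sat)))

    demand<#₁⇒totalDemand<#₁ : ∀ i → demand shades edges i < #₁ ψ (block i) → totalDemand shades edges < #₁ ψ ball
    demand<#₁⇒totalDemand<#₁ i lt =
      subst (totalDemand shades edges <_) (sym (#₁-concatSpokes ψ block)) (sumSpokes-mono-< demand≤#₁ i lt)

    module Swap (sat : Saturated) (c₂ : Class₂ (ψ c)) (a₁ : Class₁ (ψ a)) (e₁ : Class₁ (ψ e)) (ψa≢ψe : ψ a ≢ ψ e)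
                (¬ae : adj G a e ≡ false) (¬cd : adj G c d ≡ false) (¬de : adj G d e ≡ false)
                (tight : capacity edges < 8 + totalDemand shades edges)
                (demand-c≡0 : demand shades edges sc ≡ 0) (demand-e≡1 : demand shades edges se ≡ 1) where

      overfull : ∀ {m₁ m₂} → m₁ ≤ #₁ ψ ball → m₂ ≤ #₂ ψ ball
               → m₁ + m₂ ≡ 8 + totalDemand shades edges → ⊥
      overfull m₁≤ m₂≤ m₁+m₂≡ = <⇒≱ tight (subst (_≤ capacity edges) m₁+m₂≡ (within-budget m₁≤ m₂≤))

      suc+7≡8+ : ∀ m → suc m + 7 ≡ 8 + m
      suc+7≡8+ m = cong suc (+-comm m 7)

      ¬extra-at-e : ¬ (∃ λ u → Adj G e u × u ≢ b × u ≢ c × ψ u ≡ ψ a)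
      ¬extra-at-e (u , eu , u≢b , u≢c , ψu≡ψa) =
        overfull (demand<#₁⇒totalDemand<#₁ se e-block) (7≤#₂-ball sat) (suc+7≡8+ _)
        where
        u∈outer : u ∈ outer e
        u∈outer with spoke-or-outside u u≢b
        ... | inj₂ u∉core     = ∈-outer⁺ eu u∉core
        ... | inj₁ (sa , refl) = ⊥-elim (¬Adj ¬ae (Adj-sym eu))
        ... | inj₁ (sc , refl) = ⊥-elim (u≢c refl)
        ... | inj₁ (sd , refl) = ⊥-elim (¬Adj ¬de (Adj-sym eu))
        ... | inj₁ (se , refl) = ⊥-elim (Adj-irrefl eu)
        e-block : demand shades edges se < #₁ ψ (block se)
        e-block = subst (_< #₁ ψ (block se)) (sym demand-e≡1)
          (∈⇒2≤length-filter (class₁? ∘ ψ) (here refl) (there u∈outer) (Adj⇒≢ eu) e₁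
            (subst Class₁ (sym ψu≡ψa) a₁))

      ¬extra-at-c : ¬ (∃ λ u → Adj G c u × u ≢ b × u ≢ e × ψ u ≡ ψ e)
      ¬extra-at-c (u , cu , u≢b , u≢e , ψu≡ψe) =
        overfull (demand<#₁⇒totalDemand<#₁ sc c-block) (7≤#₂-ball sat) (suc+7≡8+ _)
        where
        u∈outer : u ∈ outer c
        u∈outer with spoke-or-outside u u≢b
        ... | inj₂ u∉core     = ∈-outer⁺ cu u∉core
        ... | inj₁ (sa , refl) = ⊥-elim (ψa≢ψe ψu≡ψe)
        ... | inj₁ (sc , refl) = ⊥-elim (Adj-irrefl cu)
        ... | inj₁ (sd , refl) = ⊥-elim (¬Adj ¬cd cu)
        ... | inj₁ (se , refl) = ⊥-elim (u≢e refl)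
        c-block : demand shades edges sc < #₁ ψ (block sc)
        c-block = subst (_< #₁ ψ (block sc)) (sym demand-c≡0)
          (∈⇒1≤length-filter (class₁? ∘ ψ) (there u∈outer) (subst Class₁ (sym ψu≡ψe) e₁))

      ball-without-c : List V
      ball-without-c = block sa ++ (outer c ++ (block sd ++ block se))

      ¬duplicate-of-c : ¬ (∃ λ v → v ≢ b × v ≢ c × Near b v × ψ v ≡ ψ c)
      ¬duplicate-of-c (v , v≢b , v≢c , near-v , ψv≡ψc) =
        overfull totalDemand≤#₁ 8≤#₂ (+-comm _ 8)
        where
        in-ball-without-c : ∀ {u} → u ≢ b → Near b u → u ≢ c → u ∈ ball-without-c
        in-ball-without-c u≢b near u≢c = ∈-++-∷⁻ (block sa) (near-hub⇒∈ball u≢b near) u≢c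
        7≤ : 7 ≤ #₂ ψ ball-without-c
        7≤ = 7≤#₂ ψ λ {k} k₂ → case-c (saturated-class₂ sat k₂)
          where
          case-c : ∀ {k} → (∃ λ u → u ≢ b × Near b u × ψ u ≡ k) → ∃ λ u → u ∈ ball-without-c × ψ u ≡ k
          case-c (u , u≢b , near , ψu≡k) with u ≟ c
          ... | yes refl = v , in-ball-without-c v≢b near-v v≢c , trans ψv≡ψc ψu≡k
          ... | no u≢c   = u , in-ball-without-c u≢b near u≢c , ψu≡k
        8≤#₂ : 8 ≤ #₂ ψ ball
        8≤#₂ = subst (8 ≤_) (sym (length-filter-++-∷ (class₂? ∘ ψ) (block sa) (outer c ++ (block sd ++ block se)) c₂))
                 (s≤s 7≤)

      ψ₁ ψ₂ : V → Fin 9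
      ψ₁ = recolour ψ e (ψ a)
      ψ₂ = recolour ψ₁ c (ψ e)

      P₁ : IsPackingOn (_≢ b) ψ₁
      P₁ = recolour-packingOn P (free-class₁ a₁ clash) λ u≢b _ → u≢b
        where
        clash : ∀ {u} → u ≢ b → Adj G e u → ψ u ≢ ψ a
        clash {u} u≢b eu ψu≡ψa with u ≟ c
        ... | yes refl = c₂ (subst Class₁ (sym ψu≡ψa) a₁)
        ... | no u≢c   = ¬extra-at-e (u , eu , u≢b , u≢c , ψu≡ψa)

      P₂ : IsPackingOn (_≢ b) ψ₂
      P₂ = recolour-packingOn P₁ (free-class₁ e₁ clash) λ u≢b _ → u≢b
        where
        clash : ∀ {u} → u ≢ b → Adj G c u → ψ₁ u ≢ ψ e
        clash {u} u≢b cu ψ₁u≡ψe with recolour-view ψ e (ψ a) u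
        ... | inj₁ (refl , ψ₁e≡ψa) = ψa≢ψe (trans (sym ψ₁e≡ψa) ψ₁u≡ψe)
        ... | inj₂ (u≢e , ψ₁u≡ψu)  = ¬extra-at-c (u , cu , u≢b , u≢e , trans (sym ψ₁u≡ψu) ψ₁u≡ψe)

      colouring : ∃ λ ψ′ → IsPackingOn Everywhere ψ′
      colouring = recolour ψ₂ b (ψ c) , recolour-packingOn P₂ (free-class₂ clash) λ _ u≢b → u≢b
        where
        clash : ∀ {u} → u ≢ b → u ≢ b → Near b u → ψ₂ u ≢ ψ c
        clash {u} u≢b _ near ψ₂u≡ψc with recolour-view ψ₁ c (ψ e) u
        ... | inj₁ (refl , ψ₂c≡ψe) = c₂ (subst Class₁ (trans (sym ψ₂c≡ψe) ψ₂u≡ψc) e₁)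
        ... | inj₂ (u≢c , ψ₂u≡ψ₁u) with recolour-view ψ e (ψ a) u
        ...   | inj₁ (refl , ψ₁e≡ψa) =
          c₂ (subst Class₁ (trans (sym ψ₁e≡ψa) (trans (sym ψ₂u≡ψ₁u) ψ₂u≡ψc)) a₁)
        ...   | inj₂ (_ , ψ₁u≡ψu)    =
          ¬duplicate-of-c (u , u≢b , u≢c , near , trans (sym ψ₁u≡ψu) (trans (sym ψ₂u≡ψ₁u) ψ₂u≡ψc))

    swap-colouring : Saturated → SwapAtC shades edges → ∃ λ ψ′ → IsPackingOn Everywhere ψ′
    swap-colouring sat swap@(c≡2 , a≢2 , e≢2 , a≢e , _ , ¬ae , ¬cd , ¬de) =
      let tight , demand-c≡0 , demand-e≡1 = proj₂ check swap
      in Swap.colouring sat (shade≡class2⇒class₂ c≡2) (shade≢class2⇒class₁ a≢2) (shade≢class2⇒class₁ e≢2)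
           (a≢e ∘ cong shade) ¬ae ¬cd ¬de tight demand-c≡0 demand-e≡1

  module _ (F : Fan) {ψ : V → Fin 9} (P : IsPackingOn (_≢ Fan.b F) ψ) (T : Tidy (_≢ Fan.b F) ψ) where

    open FanProperties F
    open FanColouring F P T
    private
      module Mirror = FanColouring (mirror F) P T

    colour-hub : ∃ λ ψ′ → IsPackingOn Everywhere ψ′
    colour-hub with Finₚ.all? (clashes? (λ u → ¬? (u ≟ b)) ψ b)
    ... | no ¬saturated =
      let k , free = Finₚ.¬∀⟶∃¬ 9 _ (clashes? (λ u → ¬? (u ≟ b)) ψ b) ¬saturated
      in recolour ψ b k , recolour-packingOn P (¬clashes⇒free free) λ _ u≢b → u≢b
    ... | yes sat with proj₁ check (admissible sat)
    ...   | inj₁ tight        = ⊥-elim (capacity≮7+totalDemand sat tight)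
    ...   | inj₂ (inj₁ swapC) = swap-colouring sat swapC
    ...   | inj₂ (inj₂ (a≡2 , c≢2 , d≢2 , c≢d , e-cond , ¬cd , ¬ae , ¬de)) =
      Mirror.swap-colouring sat (a≡2 , c≢2 , d≢2 , c≢d , e-cond , ¬cd , ¬ae , trans (Graph.sym G e d) ¬de)

  fan-extends : (F : Fan) → HasPacking1²2⁷Coloring (removeEdge G (Fan.a F) (Fan.b F)) → HasPacking1²2⁷Coloring G
  fan-extends F (φ , packing) =
    let ψ , P , T = tidy (λ u → ¬? (u ≟ b)) (removeEdge-packingOn packing)
        ψ′ , P′  = colour-hub F P T
    in ψ′ , packingOn⇒packing P′
    where open FanProperties F

-- Case d = e: the K₄ on a, b, c, d

module K₄Case (G : Graph) (Δ≤4 : MaxDegreeAtMost G 4) where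

  open GraphProperties G
  open Packing G

  record K₄ : Set where
    field
      a b c d : V
      ab : Adj G a b
      ac : Adj G a c
      ad : Adj G a d
      bc : Adj G b c
      bd : Adj G b d
      cd : Adj G c d

  swap-cd : K₄ → K₄
  swap-cd K = record { a = a ; b = b ; c = d ; d = c ; ab = ab ; ac = ad ; ad = ac ; bc = bd ; bd = bc ; cd = Adj-sym cd }
    where open K₄ K

  module K₄Properties (K : K₄) where

    open K₄ K public

    a≢b : a ≢ b
    a≢b = Adj⇒≢ ab
    a≢c : a ≢ c
    a≢c = Adj⇒≢ ac
    a≢d : a ≢ d
    a≢d = Adj⇒≢ ad
    b≢c : b ≢ c
    b≢c = Adj⇒≢ bc
    b≢d : b ≢ d
    b≢d = Adj⇒≢ bd
    c≢d : c ≢ d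
    c≢d = Adj⇒≢ cd

    Off : Pred V 0ℓ
    Off u = u ≢ a × u ≢ b

    off? : Decidable Off
    off? u = ¬? (u ≟ a) ×-dec ¬? (u ≟ b)

    c-off : Off c
    c-off = ≢-sym a≢c , ≢-sym b≢c

    core : List V
    core = a ∷ b ∷ c ∷ d ∷ []

    core-unique : Unique core
    core-unique = (a≢b ∷ a≢c ∷ a≢d ∷ []) ∷ (b≢c ∷ b≢d ∷ []) ∷ (c≢d ∷ []) ∷ [] ∷ []

    data Position (u : V) : Set where
      at-a    : u ≡ a → Position u
      at-b    : u ≡ b → Position u
      at-c    : u ≡ c → Position u
      at-d    : u ≡ d → Position u
      outside : u ∉ core → Position u

    position : ∀ u → Position u
    position u with u ≟ a | u ≟ b | u ≟ c | u ≟ d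
    ... | yes u≡a | _       | _       | _       = at-a u≡a
    ... | no _    | yes u≡b | _       | _       = at-b u≡b
    ... | no _    | no _    | yes u≡c | _       = at-c u≡c
    ... | no _    | no _    | no _    | yes u≡d = at-d u≡d
    ... | no u≢a  | no u≢b  | no u≢c  | no u≢d  = outside λ
      { (here u≡a) → u≢a u≡a
      ; (there (here u≡b)) → u≢b u≡b
      ; (there (there (here u≡c))) → u≢c u≡c
      ; (there (there (there (here u≡d)))) → u≢d u≡d }

    ∉core⇒off : ∀ {u} → u ∉ core → Off u
    ∉core⇒off u∉core = (λ u≡a → u∉core (here u≡a)) , (λ u≡b → u∉core (there (here u≡b)))

    open Outside G core public

    outer-length≤1 : ∀ {y x₁ x₂ x₃} → Unique (x₁ ∷ x₂ ∷ x₃ ∷ []) → All (_∈ core) (x₁ ∷ x₂ ∷ x₃ ∷ [])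
                   → All (Adj G y) (x₁ ∷ x₂ ∷ x₃ ∷ []) → length (outer y) ≤ 1
    outer-length≤1 {y} xs! xs⊆core adjs = m+n≤o⇒m≤o∸n _ (≤-trans (length-outer++≤degree y xs! xs⊆core adjs) (Δ≤4 y))

    outer-a : length (outer a) ≤ 1
    outer-a = outer-length≤1 ((b≢c ∷ b≢d ∷ []) ∷ (c≢d ∷ []) ∷ [] ∷ [])
      (there (here refl) ∷ there (there (here refl)) ∷ there (there (there (here refl))) ∷ []) (ab ∷ ac ∷ ad ∷ [])

    outer-b : length (outer b) ≤ 1
    outer-b = outer-length≤1 ((a≢c ∷ a≢d ∷ []) ∷ (c≢d ∷ []) ∷ [] ∷ [])
      (here refl ∷ there (there (here refl)) ∷ there (there (there (here refl))) ∷ []) (Adj-sym ab ∷ bc ∷ bd ∷ [])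

    outer-c : length (outer c) ≤ 1
    outer-c = outer-length≤1 ((a≢b ∷ a≢d ∷ []) ∷ (b≢d ∷ []) ∷ [] ∷ [])
      (here refl ∷ there (here refl) ∷ there (there (there (here refl))) ∷ []) (Adj-sym ac ∷ Adj-sym bc ∷ cd ∷ [])

    outer-d : length (outer d) ≤ 1
    outer-d = outer-length≤1 ((a≢b ∷ a≢c ∷ []) ∷ (b≢c ∷ []) ∷ [] ∷ [])
      (here refl ∷ there (here refl) ∷ there (there (here refl)) ∷ []) (Adj-sym ad ∷ Adj-sym bd ∷ Adj-sym cd ∷ [])

  module K₄Colouring (K : K₄) {ψ : V → Fin 9}
                     (P : IsPackingOn (K₄Properties.Off K) ψ) (T : Tidy (K₄Properties.Off K) ψ) where

    open K₄Properties K

    far : V → List V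
    far x = filter (class₂? ∘ ψ) (outer x)

    ∈-far⁻ : ∀ {x u} → u ∈ far x → u ∈ outer x × Class₂ (ψ u)
    ∈-far⁻ {x} = ∈-filter⁻ (class₂? ∘ ψ) {xs = outer x}

    own : V → List V
    own y = filter (class₂? ∘ ψ) (outer y) ++ concatMap far (outer y)

    shared : V → List V
    shared z = filter (class₂? ∘ ψ) (c ∷ d ∷ outer z ++ (outer c ++ outer d))

    reach : V → V → List V
    reach y z = shared z ++ own y

    ∈-reach-shared : ∀ y z {u} → u ∈ c ∷ d ∷ outer z ++ (outer c ++ outer d) → Class₂ (ψ u) → u ∈ reach y z
    ∈-reach-shared y z u∈ u₂ = ∈-++⁺ˡ (∈-filter⁺ (class₂? ∘ ψ) u∈ u₂)

    ∈-reach-own : ∀ y z {u} → u ∈ outer y → Class₂ (ψ u) → u ∈ reach y z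
    ∈-reach-own y z u∈ u₂ = ∈-++⁺ʳ (shared z) (∈-++⁺ˡ (∈-filter⁺ (class₂? ∘ ψ) u∈ u₂))

    ∈-reach-far : ∀ y z {w u} → w ∈ outer y → u ∈ outer w → Class₂ (ψ u) → u ∈ reach y z
    ∈-reach-far y z w∈ u∈ u₂ =
      ∈-++⁺ʳ (shared z) (∈-++⁺ʳ (filter (class₂? ∘ ψ) (outer y))
        (∈-concat⁺′ (∈-filter⁺ (class₂? ∘ ψ) u∈ u₂) (∈-map⁺ far w∈)))

    reach-covers : ∀ {y z} → (y ≡ a × z ≡ b) ⊎ (y ≡ b × z ≡ a)
                 → ∀ {u} → Off u → u ≢ y → Near y u → Class₂ (ψ u) → u ∈ reach y z
    reach-covers {y} {z} yz {u} u-off u≢y near u₂ with position u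
    ... | at-a refl = ⊥-elim (proj₁ u-off refl)
    ... | at-b refl = ⊥-elim (proj₂ u-off refl)
    ... | at-c refl = ∈-reach-shared y z (here refl) u₂
    ... | at-d refl = ∈-reach-shared y z (there (here refl)) u₂
    ... | outside u∉core with near
    ...   | inj₁ yu = ∈-reach-own y z (∈-outer⁺ yu u∉core) u₂
    ...   | inj₂ (w , yw , wu) with position w | yz
    ...     | at-a refl | inj₁ (refl , _)   = ⊥-elim (Adj-irrefl yw)
    ...     | at-a refl | inj₂ (_ , refl)   = ∈-reach-shared y z (there (there (∈-++⁺ˡ (∈-outer⁺ wu u∉core)))) u₂
    ...     | at-b refl | inj₁ (_ , refl)   = ∈-reach-shared y z (there (there (∈-++⁺ˡ (∈-outer⁺ wu u∉core)))) u₂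
    ...     | at-b refl | inj₂ (refl , _)   = ⊥-elim (Adj-irrefl yw)
    ...     | at-c refl | _ = ∈-reach-shared y z (there (there (∈-++⁺ʳ (outer z) (∈-++⁺ˡ (∈-outer⁺ wu u∉core))))) u₂
    ...     | at-d refl | _ =
      ∈-reach-shared y z (there (there (∈-++⁺ʳ (outer z) (∈-++⁺ʳ (outer c) (∈-outer⁺ wu u∉core))))) u₂
    ...     | outside w∉core | _ = ∈-reach-far y z (∈-outer⁺ yw w∉core) (∈-outer⁺ wu u∉core) u₂

    far-length : ∀ {y x} → y ∈ core → Adj G x y → length (far x) ≤ 3
    far-length {y} {x} y∈core xy = ≤-trans (length-filter (class₂? ∘ ψ) (outer x))
      (m+n≤o⇒m≤o∸n _ (≤-trans (length-outer++≤degree x ([] ∷ []) (y∈core ∷ []) (xy ∷ [])) (Δ≤4 x)))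

    far-length-class₂ : ∀ {y x} → y ∈ core → ¬ Off y → Adj G x y → x ∉ core → Class₂ (ψ x) → length (far x) ≤ 1
    far-length-class₂ {y} {x} y∈core y-on xy x∉core x₂
      with T (∉core⇒off x∉core) x₂ first | T (∉core⇒off x∉core) x₂ second
    ... | u₀ , u₀-off , xu₀ , ψu₀≡0 | u₁ , u₁-off , xu₁ , ψu₁≡1 =
      m+n≤o⇒m≤o∸n _ (≤-trans (subst (_≤ degree G x) (length-++ (far x)) (length≤degree distinct neighbours)) (Δ≤4 x))
      where
      others : List V
      others = y ∷ u₀ ∷ u₁ ∷ []
      y≢off : ∀ {u} → Off u → y ≢ u
      y≢off u-off y≡u = y-on (subst Off (sym y≡u) u-off)
      distinct : Unique (far x ++ others)
      distinct = Uniqueₚ.++⁺ (Uniqueₚ.filter⁺ (class₂? ∘ ψ) (Uniqueₚ.filter⁺ (outside? x) (Uniqueₚ.allFin⁺ (n G))))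
        ((y≢off u₀-off ∷ y≢off u₁-off ∷ []) ∷ (colour-≢⇒≢ ψ ψu₀≡0 ψu₁≡1 0≢1 ∷ []) ∷ [] ∷ [])
        λ (v∈far , v∈others) →
          not-far (proj₂ (∈-far⁻ v∈far)) (proj₂ (∈-outer⁻ (proj₁ (∈-far⁻ v∈far)))) v∈others
        where
        not-far : ∀ {v} → Class₂ (ψ v) → v ∉ core → v ∉ others
        not-far _  v∉core (here refl)            = v∉core y∈core
        not-far v₂ _ (there (here refl))         = v₂ (subst Class₁ (sym ψu₀≡0) first)
        not-far v₂ _ (there (there (here refl))) = v₂ (subst Class₁ (sym ψu₁≡1) second)
      neighbours : All (Adj G x) (far x ++ others)
      neighbours = All.tabulate λ {v} v∈ → [ (λ v∈far → proj₁ (∈-outer⁻ (proj₁ (∈-far⁻ v∈far))))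
                                                      , All.lookup (xy ∷ xu₀ ∷ xu₁ ∷ []) ] (∈-++⁻ (far x) v∈)

    own-length : ∀ {y} → y ∈ core → ¬ Off y → length (outer y) ≤ 1 → length (own y) + #₂ ψ (outer y) ≤ 3
    own-length {y} y∈core y-on outer≤1 = bound (outer y) outer≤1 ∈-outer⁻
      where
      bound : ∀ xs → length xs ≤ 1 → (∀ {x} → x ∈ xs → Adj G y x × x ∉ core)
            → length (filter (class₂? ∘ ψ) xs ++ concatMap far xs) + #₂ ψ xs ≤ 3
      bound []          _        _     = z≤n
      bound (_ ∷ _ ∷ _) (s≤s ()) _
      bound (x ∷ [])    _        props with class₁? (ψ x)
      ... | yes _  = +-mono-≤ (subst (_≤ 3) (cong length (sym (++-identityʳ (far x))))
                                (far-length y∈core (Adj-sym (proj₁ (props (here refl)))))) (z≤n {0})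
      ... | no x₂  = +-mono-≤ (s≤s (subst (_≤ 1) (cong length (sym (++-identityʳ (far x))))
                                (far-length-class₂ y∈core y-on (Adj-sym (proj₁ (props (here refl))))
                                  (proj₂ (props (here refl))) x₂))) (≤-refl {1})

    shared-length : ∀ z → length (shared z)
                  ≡ #₂ ψ (c ∷ []) + (#₂ ψ (d ∷ []) + (#₂ ψ (outer z) + (#₂ ψ (outer c) + #₂ ψ (outer d))))
    shared-length z =
      trans (#₂-++ ψ (c ∷ []) _) (cong (#₂ ψ (c ∷ []) +_) (trans (#₂-++ ψ (d ∷ []) _) (cong (#₂ ψ (d ∷ []) +_)
        (trans (#₂-++ ψ (outer z) _) (cong (#₂ ψ (outer z) +_) (#₂-++ ψ (outer c) (outer d)))))))

    reach-length : ∀ y z {m₁ m₂ m₃ m₄ m₅ m₆} → #₂ ψ (c ∷ []) ≤ m₁ → #₂ ψ (d ∷ []) ≤ m₂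
                 → #₂ ψ (outer z) ≤ m₃ → #₂ ψ (outer c) ≤ m₄ → #₂ ψ (outer d) ≤ m₅ → length (own y) ≤ m₆
                 → length (reach y z) ≤ m₁ + (m₂ + (m₃ + (m₄ + m₅))) + m₆
    reach-length y z c≤ d≤ z≤ oc≤ od≤ own≤ =
      subst (_≤ _) (sym (trans (length-++ (shared z)) (cong (_+ length (own y)) (shared-length z))))
        (+-mono-≤ (+-mono-≤ c≤ (+-mono-≤ d≤ (+-mono-≤ z≤ (+-mono-≤ oc≤ od≤)))) own≤)

    #₂-singleton : ∀ x → #₂ ψ (x ∷ []) ≤ 1
    #₂-singleton x = length-filter (class₂? ∘ ψ) (x ∷ [])

    #₂-singleton-class₁ : ∀ {x} → Class₁ (ψ x) → #₂ ψ (x ∷ []) ≤ 0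
    #₂-singleton-class₁ {x} x₁ with class₁? (ψ x)
    ... | yes _  = z≤n
    ... | no x₂  = ⊥-elim (x₂ x₁)

    #₂-outer : ∀ y → length (outer y) ≤ 1 → #₂ ψ (outer y) ≤ 1
    #₂-outer y outer≤1 = ≤-trans (length-filter (class₂? ∘ ψ) (outer y)) outer≤1

    #₂-outer-class₁ : ∀ {y x} → length (outer y) ≤ 1 → x ∈ outer y → Class₁ (ψ x) → #₂ ψ (outer y) ≤ 0
    #₂-outer-class₁ {y} {x} outer≤1 x∈ x₁ = bound (outer y) outer≤1 x∈
      where
      bound : ∀ xs → length xs ≤ 1 → x ∈ xs → #₂ ψ xs ≤ 0
      bound (_ ∷ [])    _        (here refl) = #₂-singleton-class₁ x₁
      bound (_ ∷ _ ∷ _) (s≤s ()) _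

    a-on : ¬ Off a
    a-on (a≢a , _) = a≢a refl

    b-on : ¬ Off b
    b-on (_ , b≢b) = b≢b refl

    own-a : length (own a) + #₂ ψ (outer a) ≤ 3
    own-a = own-length (here refl) a-on outer-a

    own-b : length (own b) + #₂ ψ (outer b) ≤ 3
    own-b = own-length (there (here refl)) b-on outer-b

    free-at-a : (extra : List (Fin 9)) → length (reach a b) + length extra ≤ 6
              → ∃ λ k → Class₂ k × k ∉ extra × ¬ Clashes Off ψ a k
    free-at-a = free-class₂-colour off? (reach a b) (reach-covers (inj₁ (refl , refl)))

    free-at-b : (extra : List (Fin 9)) → length (reach b a) + length extra ≤ 6
              → ∃ λ k → Class₂ k × k ∉ extra × ¬ Clashes Off ψ b k
    free-at-b = free-class₂-colour off? (reach b a) (reach-covers (inj₂ (refl , refl)))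

    class₁≢class₂ : ∀ {j k} → Class₁ j → Class₂ k → j ≢ k
    class₁≢class₂ j₁ k₂ refl = k₂ j₁

    ∉-singleton⁻ : ∀ {k k′ : Fin 9} → k ∉ k′ ∷ [] → k ≢ k′
    ∉-singleton⁻ k∉ k≡k′ = k∉ (here k≡k′)

    finish : ∀ {α β} → α ≢ β → ¬ Clashes Off ψ a α → ¬ Clashes Off ψ b β
           → ∃ λ ψ′ → IsPackingOn Everywhere ψ′
    finish {α} {β} α≢β free-a free-b =
      recolour ψ₁ b β ,
      recolour-packingOn P₁ (¬clashes⇒free (¬clashes-recolour free-b α≢β λ u≢b u≢a → u≢a , u≢b)) λ _ u≢b → u≢b
      where
      ψ₁ : V → Fin 9
      ψ₁ = recolour ψ a α
      P₁ : IsPackingOn (_≢ b) ψ₁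
      P₁ = recolour-packingOn P (¬clashes⇒free free-a) λ u≢b u≢a → u≢a , u≢b

    coloured-neighbour? : ∀ y j → Dec (∃ λ u → Off u × Adj G y u × ψ u ≡ j)
    coloured-neighbour? y j = Finₚ.any? λ u → off? u ×-dec Adj? y u ×-dec (ψ u ≟ j)

    c-neighbour : ∀ {u} → Off u → Adj G c u → u ≡ d ⊎ u ∈ outer c
    c-neighbour {u} u-off cu with position u
    ... | at-a refl       = ⊥-elim (proj₁ u-off refl)
    ... | at-b refl       = ⊥-elim (proj₂ u-off refl)
    ... | at-c refl       = ⊥-elim (Adj-irrefl cu)
    ... | at-d u≡d        = inj₁ u≡d
    ... | outside u∉core  = inj₂ (∈-outer⁺ cu u∉core)

    c-sees-both : Class₂ (ψ c) → Class₁ (ψ d) × ∃ λ x → x ∈ outer c × Class₁ (ψ x) × ψ x ≢ ψ d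
    c-sees-both c₂ with T c-off c₂ first | T c-off c₂ second
    ... | u₀ , u₀-off , cu₀ , ψu₀≡0 | u₁ , u₁-off , cu₁ , ψu₁≡1
      with c-neighbour u₀-off cu₀ | c-neighbour u₁-off cu₁
    ...   | inj₁ refl | inj₁ refl = ⊥-elim (0≢1 (trans (sym ψu₀≡0) ψu₁≡1))
    ...   | inj₁ refl | inj₂ u₁∈  = subst Class₁ (sym ψu₀≡0) first ,
      u₁ , u₁∈ , subst Class₁ (sym ψu₁≡1) second , λ ψu₁≡ψd → 0≢1 (trans (trans (sym ψu₀≡0) (sym ψu₁≡ψd)) ψu₁≡1)
    ...   | inj₂ u₀∈  | inj₁ refl = subst Class₁ (sym ψu₁≡1) second ,
      u₀ , u₀∈ , subst Class₁ (sym ψu₀≡0) first , λ ψu₀≡ψd → 0≢1 (trans (sym ψu₀≡0) (trans ψu₀≡ψd ψu₁≡1))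
    ...   | inj₂ u₀∈  | inj₂ u₁∈  = ⊥-elim (1+n≰n (≤-trans two outer-c))
      where
      two : 2 ≤ length (outer c)
      two = Unique-⊆⇒length≤ ((colour-≢⇒≢ ψ ψu₀≡0 ψu₁≡1 0≢1 ∷ []) ∷ [] ∷ [])
        λ { (here refl) → u₀∈ ; (there (here refl)) → u₁∈ }

    module CaseB (c₂ : Class₂ (ψ c)) (d₁ : Class₁ (ψ d)) {x : V}
                 (x∈ : x ∈ outer c) (x₁ : Class₁ (ψ x)) (ψx≢ψd : ψ x ≢ ψ d) where

      blocked-outer : ∀ {y} → length (outer y) ≤ 1 → (∃ λ u → Off u × Adj G y u × ψ u ≡ ψ x) → #₂ ψ (outer y) ≤ 0
      blocked-outer {y} outer≤1 (u , u-off , yu , ψu≡ψx) = #₂-outer-class₁ outer≤1 u∈ (subst Class₁ (sym ψu≡ψx) x₁)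
        where
        u∈ : u ∈ outer y
        u∈ with position u
        ... | at-a refl      = ⊥-elim (proj₁ u-off refl)
        ... | at-b refl      = ⊥-elim (proj₂ u-off refl)
        ... | at-c refl      = ⊥-elim (c₂ (subst Class₁ (sym ψu≡ψx) x₁))
        ... | at-d refl      = ⊥-elim (ψx≢ψd (sym ψu≡ψx))
        ... | outside u∉core = ∈-outer⁺ yu u∉core

      reach-length-c-class₂ : ∀ y z {m₃ m₆} → #₂ ψ (outer z) ≤ m₃ → length (own y) ≤ m₆
                            → length (reach y z) ≤ 1 + (0 + (m₃ + (0 + 1))) + m₆
      reach-length-c-class₂ y z z≤ own≤ = reach-length y z (#₂-singleton c) (#₂-singleton-class₁ d₁) z≤
        (#₂-outer-class₁ outer-c x∈ x₁) (#₂-outer d outer-d) own≤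

      colouring : ∃ λ ψ′ → IsPackingOn Everywhere ψ′
      colouring with coloured-neighbour? a (ψ x)
      ... | no none-a =
        let β , β₂ , _ , free-b = free-at-b [] (+-mono-≤ (reach-length-c-class₂ b a (#₂-outer a outer-a)
                                    (m+n≤o⇒m≤o _ own-b)) (z≤n {0}))
        in finish (class₁≢class₂ x₁ β₂) (¬clashes-class₁ x₁ none-a) free-b
      ... | yes seen-a with coloured-neighbour? b (ψ x)
      ...   | no none-b =
        let α , α₂ , _ , free-a = free-at-a [] (+-mono-≤ (reach-length-c-class₂ a b (#₂-outer b outer-b)
                                    (m+n≤o⇒m≤o _ own-a)) (z≤n {0}))
        in finish (≢-sym (class₁≢class₂ x₁ α₂)) free-a (¬clashes-class₁ x₁ none-b)
      ...   | yes seen-b =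
        let β , _ , _ , free-b = free-at-b [] (≤-trans (+-mono-≤ (reach-length-c-class₂ b a (blocked-outer outer-a seen-a)
                                    (m+n≤o⇒m≤o _ own-b)) (z≤n {0})) (n≤1+n 5))
            α , _ , α∉[β] , free-a = free-at-a (β ∷ []) (+-mono-≤ (reach-length-c-class₂ a b (blocked-outer outer-b seen-b)
                                        (m+n≤o⇒m≤o _ own-a)) (≤-refl {1}))
        in finish (∉-singleton⁻ α∉[β]) free-a free-b

    colouring-if-c-class₂ : Class₂ (ψ c) → ∃ λ ψ′ → IsPackingOn Everywhere ψ′
    colouring-if-c-class₂ c₂ =
      let d₁ , _ , x∈ , x₁ , ψx≢ψd = c-sees-both c₂ in CaseB.colouring c₂ d₁ x∈ x₁ ψx≢ψd

    module CaseA (c₁ : Class₁ (ψ c)) (d₁ : Class₁ (ψ d)) where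

      reach-length-class₁ : ∀ y z {m₃ m₆} → #₂ ψ (outer z) ≤ m₃ → length (own y) ≤ m₆
                          → length (reach y z) ≤ 0 + (0 + (m₃ + (1 + 1))) + m₆
      reach-length-class₁ y z z≤ own≤ = reach-length y z (#₂-singleton-class₁ c₁) (#₂-singleton-class₁ d₁) z≤
        (#₂-outer c outer-c) (#₂-outer d outer-d) own≤

      colouring : ∃ λ ψ′ → IsPackingOn Everywhere ψ′
      colouring with #₂ ψ (outer b) ℕ.≟ 0
      ... | yes ob≡0 =
        let β , _ , _ , free-b = free-at-b [] (+-mono-≤ (reach-length-class₁ b a (#₂-outer a outer-a)
                                    (m+n≤o⇒m≤o _ own-b)) (z≤n {0}))
            α , _ , α∉[β] , free-a = free-at-a (β ∷ []) (+-mono-≤ (reach-length-class₁ a b (≤-reflexive ob≡0)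
                                        (m+n≤o⇒m≤o _ own-a)) (≤-refl {1}))
        in finish (∉-singleton⁻ α∉[β]) free-a free-b
      ... | no ob≢0 =
        let α , _ , _ , free-a = free-at-a [] (+-mono-≤ (reach-length-class₁ a b (#₂-outer b outer-b)
                                    (m+n≤o⇒m≤o _ own-a)) (z≤n {0}))
            β , _ , β∉[α] , free-b = free-at-b (α ∷ []) (+-mono-≤ (reach-length-class₁ b a (#₂-outer a outer-a)
                                        (≤-trans (m+n≤o⇒m≤o∸n _ own-b) (∸-monoʳ-≤ 3 (n≢0⇒n>0 ob≢0)))) (≤-refl {1}))
        in finish (≢-sym (∉-singleton⁻ β∉[α])) free-a free-b

  colour-a-b : (K : K₄) → ∀ {ψ} → IsPackingOn (K₄Properties.Off K) ψ → Tidy (K₄Properties.Off K) ψ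
             → ∃ λ ψ′ → IsPackingOn Everywhere ψ′
  colour-a-b K {ψ} P T with class₁? (ψ (K₄.c K)) | class₁? (ψ (K₄.d K))
  ... | no c₂  | _      = K₄Colouring.colouring-if-c-class₂ K P T c₂
  ... | yes _  | no d₂  = K₄Colouring.colouring-if-c-class₂ (swap-cd K) P T d₂
  ... | yes c₁ | yes d₁ = K₄Colouring.CaseA.colouring K P T c₁ d₁

  K₄-extends : (K : K₄) → HasPacking1²2⁷Coloring (removeEdge G (K₄.a K) (K₄.b K)) → HasPacking1²2⁷Coloring G
  K₄-extends K (φ , packing) =
    let ψ , P , T = tidy off? (removeEdge-packingOn-off G a b packing)
        ψ′ , P′  = colour-a-b K P T
    in ψ′ , packingOn⇒packing P′
    where open K₄Properties K

lemma3p5 : (G : Graph) → MinimalBad G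
    → ∀ a b c → Triangle G a b c
    → ¬ (EdgeShared G a b c × EdgeShared G b c a)
lemma3p5 G minimal a b c (ab , bc , ca) ((d , d≢c , ad , bd) , (e , e≢a , be , ce)) =
  minimalBad-removeEdge minimal ab colouring-extends
  where
  open GraphProperties G using (Adj-sym)
  Δ≤4 : MaxDegreeAtMost G 4
  Δ≤4 = proj₁ (proj₂ (proj₁ minimal))
  colouring-extends : HasPacking1²2⁷Coloring (removeEdge G a b) → HasPacking1²2⁷Coloring G
  colouring-extends with d ≟ e
  ... | no d≢e   = FanCase.fan-extends G Δ≤4 record
    { a = a ; b = b ; c = c ; d = d ; e = e ; ab = ab ; ac = Adj-sym ca ; bc = bc ; ad = ad ; bd = bd
    ; be = be ; ce = ce ; d≢c = d≢c ; e≢a = e≢a ; d≢e = d≢e }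
  ... | yes refl = K₄Case.K₄-extends G Δ≤4 record
    { a = a ; b = b ; c = c ; d = d ; ab = ab ; ac = Adj-sym ca ; ad = ad ; bc = bc ; bd = bd ; cd = ce }
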